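{- The linear map $\Theta:\mathbf{H}_o\to\mathbf{FQSym}$ defined on ordered forests by $\Theta(\mathbb{F})=\sum_{\sigma\in S_{\mathbb{F}}}\sigma$ is a morphism of Hopf algebras, homogeneous of degree $0$ (it maps ordered forests with $n$ vertices into the span of $\Sigma_n$).
   Context: Rooted forest: a finite graph each of whose connected components is a rooted tree; edges are oriented towards the roots. For distinct vertices $i,j$ write $i\twoheadrightarrow j$ if there is an oriented path from $i$ to $j$ (i.e. $j$ lies strictly below $i$ on the way to the root). An ordered forest with $n$ vertices is a rooted forest whose vertex set is identified with $\{1,\dots,n\}$ (equivalently, carries a total order), considered up to isomorphism preserving roots and order. $\mathbf{H}_o$ is the vector space (over $\mathbb{R}$ or $\mathbb{C}$) with basis the ordered forests (including the empty forest $1$), graded by number of vertices. Product: for ordered forests $\mathbb{F}$ ($k$ vertices) and $\mathbb{G}$, $\mathbb{F}\mathbb{G}$ is the disjoint union, where the vertices of $\mathbb{F}$ keep labels $1,\dots,k$ and the vertex $j$ of $\mathbb{G}$ becomes $k+j$. An admissible cut of $\mathbb{F}$ is a subset $\vec v$ of vertices (possibly empty) such that no two distinct elements $v,w\in\vec v$ satisfy $v\twoheadrightarrow w$. $\mathrm{Lea}_{\vec v}\mathbb{F}$ is the subforest on the vertices $\vec v\cup\{w:\exists v\in\vec v,\ w\twoheadrightarrow v\}$ and $\mathrm{Roo}_{\vec v}\mathbb{F}$ the subforest on the remaining vertices, both with the induced order (relabelled increasingly). Coproduct: $\Delta(\mathbb{F})=\sum_{\vec v\text{ admissible}}\mathrm{Roo}_{\vec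 v}\mathbb{F}\otimes\mathrm{Lea}_{\vec v}\mathbb{F}$; this makes $\mathbf{H}_o$ a graded Hopf algebra. $\mathbf{FQSym}$ (Malvenuto–Reutenauer algebra) has basis $\bigsqcup_{n\ge0}\Sigma_n$. Composition is $(\sigma\circ\tau)(i)=\sigma(\tau(i))$. For $\sigma\in\Sigma_k,\tau\in\Sigma_l$, $\sigma\otimes\tau\in\Sigma_{k+l}$ is $i\mapsto\sigma(i)$ for $i\le k$ and $k+j\mapsto k+\tau(j)$. $Sh(k,l)$ is the set of $\zeta\in\Sigma_{k+l}$ with $\zeta^{ -1}(1)<\dots<\zeta^{ -1}(k)$ and $\zeta^{ -1}(k+1)<\dots<\zeta^{ -1}(k+l)$. Product: $\sigma\cdot\tau=\sum_{\epsilon\in Sh(k,l)}(\sigma\otimes\tau)\circ\epsilon$. Coproduct: for $\sigma\in\Sigma_n$, $\Delta(\sigma)=\sum_{k=0}^n\sum\sigma_1\otimes\sigma_2$, where the inner sum is over the (unique) decomposition $\sigma=\zeta^{ -1}\circ(\sigma_1\otimes\sigma_2)$ with $\zeta\in Sh(k,n-k)$, $\sigma_1\in\Sigma_k$, $\sigma_2\in\Sigma_{n-k}$. For an ordered forest $\mathbb{F}$ with $n$ vertices, $S_{\mathbb{F}}$ is the set of $\sigma\in\Sigma_n$ such that for all vertices $i,j$: $i\twoheadrightarrow j$ implies $\sigma^{ -1}(i)>\sigma^{ -1}(j)$. -}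

module Defs where

open import Data.Nat using (ℕ; zero; suc; _+_; _∸_; _<ᵇ_; _≡ᵇ_)
open import Data.Fin using (Fin; zero; suc; toℕ; _↑ˡ_; _↑ʳ_)
open import Data.Vec as Vec using (Vec; []; _∷_; lookup; tabulate)
open import Data.List as List using (List; []; _∷_; [_]; concatMap; filterᵇ; upTo; length)
open import Data.Maybe as Maybe using (Maybe; just; nothing; _>>=_; fromMaybe)
open import Data.Bool.ListAction using (all; any)
open import Data.Bool using (Bool; true; false; _∧_; _∨_; not; if_then_else_)
open import Data.Product using (Σ; _×_; _,_)
open import Relation.Binary.PropositionalEquality using (_≡_)

_==ᶠ_ : ∀ {n} → Fin n → Fin n → Bool
i ==ᶠ j = toℕ i ≡ᵇ toℕ j

_<ᶠ_ : ∀ {n} → Fin n → Fin n → Bool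
i <ᶠ j = toℕ i <ᵇ toℕ j

allᶠ : ∀ {n} → (Fin n → Bool) → Bool
allᶠ {n} f = all f (List.allFin n)

anyᶠ : ∀ {n} → (Fin n → Bool) → Bool
anyᶠ {n} f = any f (List.allFin n)

_==ₘ_ : ∀ {n} → Maybe (Fin n) → Maybe (Fin n) → Bool
just i ==ₘ just j = i ==ᶠ j
nothing ==ₘ nothing = true
_ ==ₘ _ = false

_==ₗ_ : List ℕ → List ℕ → Bool
[] ==ₗ [] = true
(x ∷ xs) ==ₗ (y ∷ ys) = (x ≡ᵇ y) ∧ (xs ==ₗ ys)
_ ==ₗ _ = false

first : ∀ {n} → (Fin n → Bool) → Maybe (Fin n)
first {zero} f = nothing
first {suc n} f = if f zero then just zero else Maybe.map suc (first (λ i → f (suc i)))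

-- A permutation σ ∈ Σ_n is stored as its word
-- (σ(1), …, σ(n)) : Vec (Fin n) n, i.e. σ(i) = lookup σ i.
-- An element of (the N-span inside) FQSym of degree n is a finite formal
-- sum of permutations, represented as a List (Perm n) (multiset of
-- basis elements with multiplicity); equality is up to permutation of the list.

Perm : ℕ → Set
Perm n = Vec (Fin n) n

allWords : ∀ {n} (m : ℕ) → List (Vec (Fin n) m)
allWords zero = [ [] ]
allWords {n} (suc m) = concatMap (λ i → List.map (i ∷_) (allWords m)) (List.allFin n)

isPerm : ∀ {n} → Perm n → Bool
isPerm σ = allᶠ λ a → allᶠ λ b → (a ==ᶠ b) ∨ not (lookup σ a ==ᶠ lookup σ b)

Sym : (n : ℕ) → List (Perm n)
Sym n = filterᵇ isPerm (allWords n)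

inv : ∀ {n} → Perm n → Perm n
inv {zero} σ = []
inv {suc n} σ = tabulate λ v → fromMaybe zero (first λ a → lookup σ a ==ᶠ v)

_∘ₚ_ : ∀ {n} → Perm n → Perm n → Perm n
σ ∘ₚ τ = Vec.map (lookup σ) τ

_⊗ₚ_ : ∀ {k l} → Perm k → Perm l → Perm (k + l)
_⊗ₚ_ {k} {l} σ τ = Vec.map (_↑ˡ l) σ Vec.++ Vec.map (k ↑ʳ_) τ

isShuffle : (k l : ℕ) → Perm (k + l) → Bool
isShuffle k l ζ =
  (allᶠ λ (a : Fin k) → allᶠ λ b →
     not (a <ᶠ b) ∨ (lookup z (a ↑ˡ l) <ᶠ lookup z (b ↑ˡ l)))
  ∧ (allᶠ λ (a : Fin l) → allᶠ λ b →
     not (a <ᶠ b) ∨ (lookup z (k ↑ʳ a) <ᶠ lookup z (k ↑ʳ b)))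
  where z = inv ζ

Sh : (k l : ℕ) → List (Perm (k + l))
Sh k l = filterᵇ (isShuffle k l) (Sym (k + l))

mulP : ∀ {k l} → Perm k → Perm l → List (Perm (k + l))
mulP {k} {l} σ τ = List.map (λ ε → (σ ⊗ₚ τ) ∘ₚ ε) (Sh k l)

mulFQ : ∀ {k l} → List (Perm k) → List (Perm l) → List (Perm (k + l))
mulFQ xs ys = concatMap (λ σ → concatMap (λ τ → mulP σ τ) ys) xs

SPerm : Set
SPerm = Σ ℕ Perm

word : ∀ {n m} → Vec (Fin n) m → List ℕ
word v = Vec.toList (Vec.map toℕ v)

ΔP : ∀ {n} → Perm n → List (SPerm × SPerm)
ΔP {n} σ = concatMap (λ k → go k (n ∸ k)) (upTo (suc n))
  where
  go : (k l : ℕ) → List (SPerm × SPerm)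
  go k l = concatMap (λ ζ → concatMap (λ σ₁ → concatMap (λ σ₂ →
             if word σ ==ₗ word (inv ζ ∘ₚ (σ₁ ⊗ₚ σ₂))
             then [ ((k , σ₁) , (l , σ₂)) ] else [])
           (Sym l)) (Sym k)) (Sh k l)

ΔFQ : ∀ {n} → List (Perm n) → List (SPerm × SPerm)
ΔFQ xs = concatMap ΔP xs

εFQ : ∀ {n} → List (Perm n) → ℕ
εFQ {zero} xs = length xs
εFQ {suc n} xs = 0

-- An ordered forest on {1..n} is given by its parent
-- function (nothing = root).  Since an order-preserving isomorphism of
-- forests on {1..n} is the identity, parent vectors are canonical
-- representatives of isomorphism classes.

Forest : ℕ → Set
Forest n = Vec (Maybe (Fin n)) n

iter : ∀ {n} → Forest n → ℕ → Fin n → Maybe (Fin n)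
iter F zero i = just i
iter F (suc k) i = iter F k i >>= lookup F

IsForest : ∀ {n} → Forest n → Set
IsForest {n} F = ∀ i → iter F n i ≡ nothing

-- i ↠ j : oriented path of length 1..n from i to j
-- (in a forest with n vertices every path has length < n)
reach : ∀ {n} → Forest n → Fin n → Fin n → Bool
reach {n} F i j = any (λ k → iter F (suc k) i ==ₘ just j) (upTo n)

inS : ∀ {n} → Forest n → Perm n → Bool
inS F σ = allᶠ λ i → allᶠ λ j →
  not (reach F i j) ∨ (lookup (inv σ) j <ᶠ lookup (inv σ) i)

-- Θ(F) = Σ_{σ ∈ S_F} σ  (homogeneous of degree 0 by its type)
Θ : ∀ {n} → Forest n → List (Perm n)
Θ {n} F = filterᵇ (inS F) (Sym n)

emptyForest : Forest 0
emptyForest = []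

-- product of ordered forests (disjoint union, G shifted by k)
_·F_ : ∀ {k l} → Forest k → Forest l → Forest (k + l)
_·F_ {k} {l} F G =
  Vec.map (Maybe.map (_↑ˡ l)) F Vec.++ Vec.map (Maybe.map (k ↑ʳ_)) G

εH : ∀ {n} → Forest n → ℕ
εH {zero} F = 1
εH {suc n} F = 0

count : ∀ {n} → Vec Bool n → ℕ
count [] = 0
count (true ∷ S) = suc (count S)
count (false ∷ S) = count S

select : ∀ {A : Set} {n} (S : Vec Bool n) → Vec A n → Vec A (count S)
select [] [] = []
select (true ∷ S) (x ∷ xs) = x ∷ select S xs
select (false ∷ S) (x ∷ xs) = select S xs

rank : ∀ {n} → Vec Bool n → Fin n → ℕ
rank (b ∷ S) zero = 0
rank (b ∷ S) (suc i) = (if b then 1 else 0) + rank S i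

toFin? : (m : ℕ) → ℕ → Maybe (Fin m)
toFin? zero x = nothing
toFin? (suc m) zero = just zero
toFin? (suc m) (suc x) = Maybe.map suc (toFin? m x)

-- induced subforest on S, relabelled increasingly
-- (toFin? never fails for q ∈ S, since rank S q < count S)
restrict : ∀ {n} (S : Vec Bool n) → Forest n → Forest (count S)
restrict S F = select S (Vec.map (λ p → p >>= λ q →
  if lookup S q then toFin? (count S) (rank S q) else nothing) F)

SForest : Set
SForest = Σ ℕ Forest

allSubsets : (n : ℕ) → List (Vec Bool n)
allSubsets zero = [ [] ]
allSubsets (suc n) = concatMap (λ b → List.map (b ∷_) (allSubsets n)) (true ∷ false ∷ [])

admissible : ∀ {n} → Forest n → Vec Bool n → Bool
admissible F c = allᶠ λ v → allᶠ λ w →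
  not (lookup c v ∧ lookup c w ∧ not (v ==ᶠ w) ∧ reach F v w)

leaSet : ∀ {n} → Forest n → Vec Bool n → Vec Bool n
leaSet F c = tabulate λ w → lookup c w ∨ (anyᶠ λ v → lookup c v ∧ reach F w v)

rooSet : ∀ {n} → Forest n → Vec Bool n → Vec Bool n
rooSet F c = Vec.map not (leaSet F c)

ΔH : ∀ {n} → Forest n → List (SForest × SForest)
ΔH {n} F = concatMap (λ c →
  if admissible F c
  then [ ((count (rooSet F c) , restrict (rooSet F c) F) ,
          (count (leaSet F c) , restrict (leaSet F c) F)) ]
  else []) (allSubsets n)

ΘΘ : List (SForest × SForest) → List (SPerm × SPerm)
ΘΘ = concatMap λ { ((k , F) , (l , G)) →
  concatMap (λ σ → List.map (λ τ → ((k , σ) , (l , τ))) (Θ G)) (Θ F) }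

-- Formal sums are lists up to reordering.  Every list compared below is
-- duplicate-free, so reordering amounts to having the same members, and the
-- proof is an analysis of members.  σ ∈ S_F exactly when σ⁻¹ strictly
-- decreases along the parent edges of F ("σ⁻¹ is a linear extension").
--
-- Unit and counit are computations.  For the product, every permutation of
-- k + l is uniquely (σ ⊗ τ) ∘ ε with ε a shuffle, and on each block its
-- inverse is σ⁻¹ (resp. τ⁻¹) followed by an increasing map; so it is a linear
-- extension of F · G iff σ and τ are linear extensions of F and G.  For the
-- coproduct, each term on either side is tagged by a set of vertices: the
-- letters of σ after the split point, resp. the leaf set of the cut.  The
-- leaf sets of admissible cuts are the upward closed sets, and for such a set
-- L the terms of ΔP σ splitting off L correspond to pairs of linear extensions
-- of the subforests on the complement of L and on L.
module Submission where

open import Defs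
open import Data.Nat as ℕ using (ℕ; zero; suc; _+_; _∸_; s≤s; z<s; s<s)
import Data.Nat.Properties as ℕP
open import Data.Fin as Fin using (Fin; zero; suc; toℕ; _↑ˡ_; _↑ʳ_; splitAt; punchOut)
import Data.Fin.Properties as FinP
open import Data.Vec as Vec using (Vec; []; _∷_; lookup; tabulate)
import Data.Vec.Properties as VecP
open import Data.List as List using (List; []; _∷_; [_]; concatMap; filterᵇ; upTo; _++_)
import Data.List.Properties as ListP
open import Data.List.Membership.Propositional using (_∈_; find; lose)
import Data.List.Membership.Propositional.Properties as MemP
open import Data.List.Membership.Propositional.Properties.WithK using (unique∧set⇒bag)
open import Data.List.Relation.Unary.Any as Any using (here; there)
import Data.List.Relation.Unary.Any.Properties as AnyP
import Data.List.Relation.Unary.All as All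
import Data.List.Relation.Unary.All.Properties as AllP
open import Data.List.Relation.Unary.AllPairs using ([]; _∷_)
open import Data.List.Relation.Unary.Unique.Propositional using (Unique)
import Data.List.Relation.Unary.Unique.Propositional.Properties as UniqP
open import Data.List.Relation.Binary.BagAndSetEquality using (∼bag⇒↭)
open import Data.List.Relation.Binary.Permutation.Propositional using (_↭_; ↭-refl)
import Data.List.Relation.Binary.Permutation.Propositional.Properties as PermP
open import Data.Maybe as Maybe using (Maybe; just; nothing; _>>=_; fromMaybe)
open import Data.Maybe.Properties using (just-injective)
open import Data.Bool using (Bool; true; false; _∧_; _∨_; not; if_then_else_; T)
open import Data.Bool.Properties using (T?; T-≡)
open import Data.Product using (Σ; _×_; _,_; proj₁; proj₂; ∃-syntax)
open import Data.Sum using (_⊎_; inj₁; inj₂; [_,_]′)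
open import Data.Unit using (tt)
open import Data.Empty using (⊥; ⊥-elim)
open import Function using (_∘_; mk⇔; Equivalence)
open import Relation.Nullary using (¬_; yes; no)
open import Relation.Binary.Definitions using (tri<; tri≈; tri>)
open import Relation.Binary.PropositionalEquality using (_≡_; _≢_; refl; sym; trans; cong; cong₂; subst; subst₂; module ≡-Reasoning)

T-∧-intro : ∀ {a b} → T a → T b → T (a ∧ b)
T-∧-intro {true} {true} _ _ = tt

T-∧-l : ∀ {a b} → T (a ∧ b) → T a
T-∧-l {true} _ = tt

T-∧-r : ∀ {a b} → T (a ∧ b) → T b
T-∧-r {true} p = p

T-∨-l : ∀ {a b} → T a → T (a ∨ b)
T-∨-l {true} _ = tt

T-∨-r : ∀ {a b} → T b → T (a ∨ b)
T-∨-r {true} _ = tt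
T-∨-r {false} p = p

T-∨-elim : ∀ {a b} → T (a ∨ b) → T a ⊎ T b
T-∨-elim {true} _ = inj₁ tt
T-∨-elim {false} p = inj₂ p

T-not-intro : ∀ {a} → ¬ T a → T (not a)
T-not-intro {true} p = p tt
T-not-intro {false} _ = tt

T-not-elim : ∀ {a} → T (not a) → ¬ T a
T-not-elim {true} ()

T-dec : ∀ b → T b ⊎ T (not b)
T-dec true = inj₁ tt
T-dec false = inj₂ tt

T-ext : ∀ {a b} → (T a → T b) → (T b → T a) → a ≡ b
T-ext {false} {false} f g = refl
T-ext {false} {true} f g = ⊥-elim (g tt)
T-ext {true} {false} f g = ⊥-elim (f tt)
T-ext {true} {true} f g = refl

-- Defs writes the implication "a implies b" as  not a ∨ b.
⇒-intro : ∀ {a b} → (T a → T b) → T (not a ∨ b)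
⇒-intro {true} f = f tt
⇒-intro {false} f = tt

⇒-elim : ∀ {a b} → T (not a ∨ b) → T a → T b
⇒-elim {true} h _ = h

allᶠ-intro : ∀ {n} (f : Fin n → Bool) → (∀ i → T (f i)) → T (allᶠ f)
allᶠ-intro {n} f h = AllP.all⁻ f (All.universal h (List.allFin n))

allᶠ-elim : ∀ {n} (f : Fin n → Bool) → T (allᶠ f) → ∀ i → T (f i)
allᶠ-elim {n} f h i = All.lookup (AllP.all⁺ f (List.allFin n) h) (MemP.∈-allFin i)

anyᶠ-intro : ∀ {n} (f : Fin n → Bool) i → T (f i) → T (anyᶠ f)
anyᶠ-intro f i h = AnyP.any⁺ f (lose (MemP.∈-allFin i) h)

anyᶠ-elim : ∀ {n} (f : Fin n → Bool) → T (anyᶠ f) → ∃[ i ] T (f i)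
anyᶠ-elim {n} f h = Any.satisfied (AnyP.any⁻ f (List.allFin n) h)

==ᶠ-sound : ∀ {n} {i j : Fin n} → T (i ==ᶠ j) → i ≡ j
==ᶠ-sound {i = i} {j} h = FinP.toℕ-injective (ℕP.≡ᵇ⇒≡ (toℕ i) (toℕ j) h)

==ᶠ-complete : ∀ {n} {i j : Fin n} → i ≡ j → T (i ==ᶠ j)
==ᶠ-complete {i = i} refl = ℕP.≡⇒≡ᵇ (toℕ i) (toℕ i) refl

<ᶠ-sound : ∀ {n} {i j : Fin n} → T (i <ᶠ j) → toℕ i ℕ.< toℕ j
<ᶠ-sound {i = i} {j} h = ℕP.<ᵇ⇒< (toℕ i) (toℕ j) h

<ᶠ-complete : ∀ {n} {i j : Fin n} → toℕ i ℕ.< toℕ j → T (i <ᶠ j)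
<ᶠ-complete h = ℕP.<⇒<ᵇ h

==ₘ-sound : ∀ {n} {x : Maybe (Fin n)} {j} → T (x ==ₘ just j) → x ≡ just j
==ₘ-sound {x = just i} h = cong just (==ᶠ-sound h)

==ₗ-sound : ∀ xs ys → T (xs ==ₗ ys) → xs ≡ ys
==ₗ-sound [] [] h = refl
==ₗ-sound (x ∷ xs) (y ∷ ys) h = cong₂ _∷_ (ℕP.≡ᵇ⇒≡ x y (T-∧-l h)) (==ₗ-sound xs ys (T-∧-r {x ℕ.≡ᵇ y} h))

==ₗ-complete : ∀ xs → T (xs ==ₗ xs)
==ₗ-complete [] = tt
==ₗ-complete (x ∷ xs) = T-∧-intro (ℕP.≡⇒≡ᵇ x x refl) (==ₗ-complete xs)

first-just : ∀ {n} (f : Fin n → Bool) (a : Fin n) → T (f a) → (∀ b → T (f b) → b ≡ a) → first f ≡ just a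
first-just {suc n} f a fa u with f zero in eq
... | true = cong just (u zero (subst T (sym eq) tt))
... | false with a
... | zero = ⊥-elim (subst T eq fa)
... | suc a' = cong (Maybe.map suc) (first-just (λ i → f (suc i)) a' fa
                  (λ b fb → FinP.suc-injective (u (suc b) fb)))

sperm-injective : ∀ {k} {a b : Perm k} → _≡_ {A = SPerm} (k , a) (k , b) → a ≡ b
sperm-injective refl = refl

nothing≢just : ∀ {A : Set} {x : A} → nothing ≢ just x
nothing≢just ()

vec-ext : ∀ {A : Set} {n} {xs ys : Vec A n} → (∀ i → lookup xs i ≡ lookup ys i) → xs ≡ ys
vec-ext {xs = xs} {ys} h =
  trans (sym (VecP.tabulate∘lookup xs)) (trans (VecP.tabulate-cong h) (VecP.tabulate∘lookup ys))

uniq-set-↭ : ∀ {A : Set} {xs ys : List A} → Unique xs → Unique ys →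
  (∀ x → x ∈ xs → x ∈ ys) → (∀ x → x ∈ ys → x ∈ xs) → xs ↭ ys
uniq-set-↭ ux uy f g = ∼bag⇒↭ (unique∧set⇒bag ux uy (mk⇔ (f _) (g _)))

uniq-map : ∀ {A B : Set} (f : A → B) (xs : List A) → Unique xs →
  (∀ x y → x ∈ xs → y ∈ xs → f x ≡ f y → x ≡ y) → Unique (List.map f xs)
uniq-map f [] u inj = []
uniq-map f (x ∷ xs) (a ∷ u) inj =
  All.tabulate (λ z∈ eq → fresh z∈ eq) ∷ uniq-map f xs u (λ p q p∈ q∈ → inj p q (there p∈) (there q∈))
  where
  fresh : ∀ {z} → z ∈ List.map f xs → f x ≡ z → ⊥
  fresh z∈ eq with MemP.∈-map⁻ f z∈
  ... | y , y∈ , refl = All.lookup a y∈ (inj x y (here refl) (there y∈) eq)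

uniq-concatMap : ∀ {A B : Set} (f : A → List B) (xs : List A) → Unique xs →
  (∀ x → x ∈ xs → Unique (f x)) →
  (∀ x y z → x ∈ xs → y ∈ xs → z ∈ f x → z ∈ f y → x ≡ y) → Unique (concatMap f xs)
uniq-concatMap f [] u uf d = []
uniq-concatMap f (x ∷ xs) (a ∷ u) uf d =
  UniqP.++⁺ (uf x (here refl))
    (uniq-concatMap f xs u (λ y y∈ → uf y (there y∈)) (λ p q z p∈ q∈ → d p q z (there p∈) (there q∈)))
    disjoint
  where
  disjoint : ∀ {z} → z ∈ f x × z ∈ concatMap f xs → ⊥
  disjoint (z∈ , z∈') with MemP.∈-concat⁻′ (List.map f xs) z∈'
  ... | ys , z∈ys , ys∈ with MemP.∈-map⁻ f ys∈
  ... | y , y∈ , refl = All.lookup a y∈ (d x y _ (here refl) (there y∈) z∈ z∈ys)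

∈-concatMap-intro : ∀ {A B : Set} (f : A → List B) {xs : List A} {x z} → x ∈ xs → z ∈ f x → z ∈ concatMap f xs
∈-concatMap-intro f x∈ z∈ = MemP.∈-concat⁺′ z∈ (MemP.∈-map⁺ f x∈)

∈-concatMap-elim : ∀ {A B : Set} (f : A → List B) (xs : List A) {z} → z ∈ concatMap f xs → ∃[ x ] (x ∈ xs × z ∈ f x)
∈-concatMap-elim f xs z∈ with MemP.∈-concat⁻′ (List.map f xs) z∈
... | ys , z∈ys , ys∈ with MemP.∈-map⁻ f ys∈
... | x , x∈ , refl = x , x∈ , z∈ys

∈-filterᵇ-intro : ∀ {A : Set} (p : A → Bool) {xs : List A} {x} → x ∈ xs → T (p x) → x ∈ filterᵇ p xs
∈-filterᵇ-intro p x∈ px = MemP.∈-filter⁺ (T? ∘ p) x∈ px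

∈-filterᵇ-elim : ∀ {A : Set} (p : A → Bool) {xs : List A} {x} → x ∈ filterᵇ p xs → x ∈ xs × T (p x)
∈-filterᵇ-elim p {xs} x∈ = MemP.∈-filter⁻ (T? ∘ p) {xs = xs} x∈

uniq-filterᵇ : ∀ {A : Set} (p : A → Bool) {xs : List A} → Unique xs → Unique (filterᵇ p xs)
uniq-filterᵇ p {xs} u = UniqP.filter⁺ (T? ∘ p) {xs} u

∈-if-intro : ∀ {A : Set} (b : Bool) {y : A} → T b → y ∈ (if b then [ y ] else [])
∈-if-intro true _ = here refl

∈-if-elim : ∀ {A : Set} (b : Bool) {y z : A} → z ∈ (if b then [ y ] else []) → T b × z ≡ y
∈-if-elim true (here refl) = tt , refl

uniq-if : ∀ {A : Set} (b : Bool) (y : A) → Unique (if b then [ y ] else [])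
uniq-if true y = All.[] ∷ []
uniq-if false y = []

IsPerm : ∀ {n} → Perm n → Set
IsPerm σ = ∀ a b → lookup σ a ≡ lookup σ b → a ≡ b

allWords-complete : ∀ {n} m (v : Vec (Fin n) m) → v ∈ allWords m
allWords-complete zero [] = here refl
allWords-complete {n} (suc m) (i ∷ v) =
  ∈-concatMap-intro (λ i → List.map (i ∷_) (allWords m)) (MemP.∈-allFin i) (MemP.∈-map⁺ (i ∷_) (allWords-complete m v))

allWords-unique : ∀ {n} m → Unique (allWords {n} m)
allWords-unique zero = All.[] ∷ []
allWords-unique {n} (suc m) =
  uniq-concatMap (λ i → List.map (i ∷_) (allWords m)) (List.allFin n) (UniqP.allFin⁺ n)
    (λ i _ → uniq-map (i ∷_) (allWords m) (allWords-unique m) (λ x y _ _ eq → VecP.∷-injectiveʳ eq))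
    (λ i j z _ _ z∈ z∈' → same-head z∈ z∈')
  where
  same-head : ∀ {i j : Fin n} {z} → z ∈ List.map (i ∷_) (allWords m) → z ∈ List.map (j ∷_) (allWords m) → i ≡ j
  same-head z∈ z∈' with MemP.∈-map⁻ _ z∈ | MemP.∈-map⁻ _ z∈'
  ... | _ , _ , refl | _ , _ , eq = VecP.∷-injectiveˡ eq

isPerm-sound : ∀ {n} (σ : Perm n) → T (isPerm σ) → IsPerm σ
isPerm-sound σ h a b eq with T-∨-elim (allᶠ-elim _ (allᶠ-elim _ h a) b)
... | inj₁ q = ==ᶠ-sound q
... | inj₂ q = ⊥-elim (T-not-elim q (==ᶠ-complete eq))

isPerm-complete : ∀ {n} (σ : Perm n) → IsPerm σ → T (isPerm σ)
isPerm-complete σ h = allᶠ-intro _ λ a → allᶠ-intro _ λ b → injective-at a b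
  where
  injective-at : ∀ a b → T ((a ==ᶠ b) ∨ not (lookup σ a ==ᶠ lookup σ b))
  injective-at a b with T-dec (lookup σ a ==ᶠ lookup σ b)
  ... | inj₁ q = T-∨-l (==ᶠ-complete (h a b (==ᶠ-sound q)))
  ... | inj₂ q = T-∨-r {a ==ᶠ b} q

Sym-complete : ∀ {n} (σ : Perm n) → IsPerm σ → σ ∈ Sym n
Sym-complete {n} σ h = ∈-filterᵇ-intro isPerm (allWords-complete n σ) (isPerm-complete σ h)

Sym-sound : ∀ {n} {σ : Perm n} → σ ∈ Sym n → IsPerm σ
Sym-sound {n} {σ} m = isPerm-sound σ (proj₂ (∈-filterᵇ-elim isPerm {allWords n} m))

Sym-unique : ∀ n → Unique (Sym n)
Sym-unique n = uniq-filterᵇ isPerm {allWords n} (allWords-unique n)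

-- An injective word of length n over Fin n hits every letter (pigeonhole).
perm-surj : ∀ {n} (σ : Perm n) → IsPerm σ → ∀ v → ∃[ a ] lookup σ a ≡ v
perm-surj {suc m} σ h v with FinP.any? (λ a → lookup σ a Fin.≟ v)
... | yes hit = hit
... | no miss = ⊥-elim (ℕP.<-irrefl refl (FinP.injective⇒≤ {f = avoid} avoid-injective))
  where
  avoid : Fin (suc m) → Fin m
  avoid a = punchOut {i = v} {j = lookup σ a} (λ eq → miss (a , sym eq))
  avoid-injective : ∀ {a b} → avoid a ≡ avoid b → a ≡ b
  avoid-injective {a} {b} eq = h a b (FinP.punchOut-injective {i = v} _ _ eq)

inv-spec : ∀ {n} (σ : Perm n) → IsPerm σ → ∀ a v → lookup σ a ≡ v → lookup (inv σ) v ≡ a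
inv-spec {suc n} σ h a v eq =
  trans (VecP.lookup∘tabulate (λ v → fromMaybe zero (first λ a → lookup σ a ==ᶠ v)) v)
    (cong (fromMaybe zero) (first-just (λ a → lookup σ a ==ᶠ v) a (==ᶠ-complete eq)
      (λ b q → h b a (trans (==ᶠ-sound q) (sym eq)))))

inv-σ : ∀ {n} (σ : Perm n) → IsPerm σ → ∀ a → lookup (inv σ) (lookup σ a) ≡ a
inv-σ σ h a = inv-spec σ h a _ refl

σ-inv : ∀ {n} (σ : Perm n) → IsPerm σ → ∀ v → lookup σ (lookup (inv σ) v) ≡ v
σ-inv σ h v with perm-surj σ h v
... | a , refl = cong (lookup σ) (inv-σ σ h a)

inv-perm : ∀ {n} (σ : Perm n) → IsPerm σ → IsPerm (inv σ)
inv-perm σ h a b eq = trans (sym (σ-inv σ h a)) (trans (cong (lookup σ) eq) (σ-inv σ h b))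

inv-inv : ∀ {n} (σ : Perm n) → IsPerm σ → inv (inv σ) ≡ σ
inv-inv σ h = vec-ext λ a → inv-spec (inv σ) (inv-perm σ h) (lookup σ a) a (inv-σ σ h a)

lookup-∘ₚ : ∀ {n} (σ τ : Perm n) i → lookup (σ ∘ₚ τ) i ≡ lookup σ (lookup τ i)
lookup-∘ₚ σ τ i = VecP.lookup-map i (lookup σ) τ

∘ₚ-perm : ∀ {n} (σ τ : Perm n) → IsPerm σ → IsPerm τ → IsPerm (σ ∘ₚ τ)
∘ₚ-perm σ τ hσ hτ a b eq = hτ a b (hσ _ _ (trans (sym (lookup-∘ₚ σ τ a)) (trans eq (lookup-∘ₚ σ τ b))))

data Split (k l : ℕ) : Fin (k + l) → Set where
  isL : ∀ a → Split k l (a ↑ˡ l)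
  isR : ∀ b → Split k l (k ↑ʳ b)

split : ∀ k l (i : Fin (k + l)) → Split k l i
split k l i with splitAt k i in eq
... | inj₁ a = subst (Split k l) (trans (cong (Fin.join k l) (sym eq)) (FinP.join-splitAt k l i)) (isL a)
... | inj₂ b = subst (Split k l) (trans (cong (Fin.join k l) (sym eq)) (FinP.join-splitAt k l i)) (isR b)

splitEq : ∀ k l (i : Fin (k + l)) → (∃[ a ] i ≡ a ↑ˡ l) ⊎ (∃[ b ] i ≡ k ↑ʳ b)
splitEq k l i with split k l i
... | isL a = inj₁ (a , refl)
... | isR b = inj₂ (b , refl)

↑ˡ≢↑ʳ : ∀ {k l} (a : Fin k) (b : Fin l) → a ↑ˡ l ≢ k ↑ʳ b
↑ˡ≢↑ʳ {k} {l} a b eq = ℕP.<⇒≢ (ℕP.<-≤-trans (subst (ℕ._< k) (sym (FinP.toℕ-↑ˡ a l)) (FinP.toℕ<n a))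
                                  (subst (k ℕ.≤_) (sym (FinP.toℕ-↑ʳ k b)) (ℕP.m≤m+n k (toℕ b)))) (cong toℕ eq)

lookup-⊗ˡ : ∀ {k l} (σ : Perm k) (τ : Perm l) a → lookup (σ ⊗ₚ τ) (a ↑ˡ l) ≡ lookup σ a ↑ˡ l
lookup-⊗ˡ {k} {l} σ τ a =
  trans (VecP.lookup-++ˡ (Vec.map (_↑ˡ l) σ) (Vec.map (k ↑ʳ_) τ) a) (VecP.lookup-map a (_↑ˡ l) σ)

lookup-⊗ʳ : ∀ {k l} (σ : Perm k) (τ : Perm l) b → lookup (σ ⊗ₚ τ) (k ↑ʳ b) ≡ k ↑ʳ lookup τ b
lookup-⊗ʳ {k} {l} σ τ b =
  trans (VecP.lookup-++ʳ (Vec.map (_↑ˡ l) σ) (Vec.map (k ↑ʳ_) τ) b) (VecP.lookup-map b (k ↑ʳ_) τ)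

⊗ₚ-perm : ∀ {k l} (σ : Perm k) (τ : Perm l) → IsPerm σ → IsPerm τ → IsPerm (σ ⊗ₚ τ)
⊗ₚ-perm {k} {l} σ τ hσ hτ i j eq with split k l i | split k l j
... | isL a | isL a' = cong (_↑ˡ l) (hσ a a' (FinP.↑ˡ-injective l _ _ (trans (sym (lookup-⊗ˡ σ τ a)) (trans eq (lookup-⊗ˡ σ τ a')))))
... | isL a | isR b' = ⊥-elim (↑ˡ≢↑ʳ _ _ (trans (sym (lookup-⊗ˡ σ τ a)) (trans eq (lookup-⊗ʳ σ τ b'))))
... | isR b | isL a' = ⊥-elim (↑ˡ≢↑ʳ _ _ (trans (sym (lookup-⊗ˡ σ τ a')) (trans (sym eq) (lookup-⊗ʳ σ τ b))))
... | isR b | isR b' = cong (k ↑ʳ_) (hτ b b' (FinP.↑ʳ-injective k _ _ (trans (sym (lookup-⊗ʳ σ τ b)) (trans eq (lookup-⊗ʳ σ τ b')))))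

IsLeft : ∀ {k l} → Fin (k + l) → Set
IsLeft {k} {l} j = ∃[ a ] j ≡ a ↑ˡ l

⊗-left⁺ : ∀ {k l} (σ : Perm k) (τ : Perm l) j → IsLeft {k} {l} j → IsLeft {k} {l} (lookup (σ ⊗ₚ τ) j)
⊗-left⁺ σ τ j (a , refl) = lookup σ a , lookup-⊗ˡ σ τ a

⊗-left⁻ : ∀ {k l} (σ : Perm k) (τ : Perm l) j → IsLeft {k} {l} (lookup (σ ⊗ₚ τ) j) → IsLeft {k} {l} j
⊗-left⁻ {k} {l} σ τ j (a , e) with split k l j
... | isL a' = a' , refl
... | isR b = ⊥-elim (↑ˡ≢↑ʳ a _ (trans (sym e) (lookup-⊗ʳ σ τ b)))

StrictMono : ∀ {k n} → (Fin k → Fin n) → Set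
StrictMono f = ∀ a b → toℕ a ℕ.< toℕ b → toℕ (f a) ℕ.< toℕ (f b)

smono-reflect : ∀ {k n} (f : Fin k → Fin n) → StrictMono f → ∀ a b → toℕ (f a) ℕ.< toℕ (f b) → toℕ a ℕ.< toℕ b
smono-reflect f m a b lt with ℕP.<-cmp (toℕ a) (toℕ b)
... | tri< x _ _ = x
... | tri≈ _ x _ = ⊥-elim (ℕP.<-irrefl (cong toℕ (cong f (FinP.toℕ-injective x))) lt)
... | tri> _ _ x = ⊥-elim (ℕP.<-asym lt (m b a x))

smono-inj : ∀ {k n} (f : Fin k → Fin n) → StrictMono f → ∀ a b → f a ≡ f b → a ≡ b
smono-inj f m a b eq with ℕP.<-cmp (toℕ a) (toℕ b)
... | tri< x _ _ = ⊥-elim (ℕP.<-irrefl (cong toℕ eq) (m a b x))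
... | tri≈ _ x _ = FinP.toℕ-injective x
... | tri> _ _ x = ⊥-elim (ℕP.<-irrefl (cong toℕ (sym eq)) (m b a x))

cast-mono : ∀ {m n} (e : m ≡ n) → StrictMono (Fin.cast e)
cast-mono e a b lt = subst₂ ℕ._<_ (sym (FinP.toℕ-cast e a)) (sym (FinP.toℕ-cast e b)) lt

-- Two increasing maps with the same image are equal: by strong induction,
-- a smallest disagreement would be hit by the other map at a smaller point.
smono-unique : ∀ {k n} (f g : Fin k → Fin n) → StrictMono f → StrictMono g →
  (∀ a → ∃[ b ] f a ≡ g b) → (∀ b → ∃[ a ] g b ≡ f a) → ∀ a → f a ≡ g a
smono-unique {k} f g mf mg fg gf a = agree (suc (toℕ a)) a ℕP.≤-refl
  where
  agree : ∀ m a → toℕ a ℕ.< m → f a ≡ g a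
  agree (suc m) a lt with ℕP.<-cmp (toℕ (f a)) (toℕ (g a))
  ... | tri≈ _ x _ = FinP.toℕ-injective x
  ... | tri< x _ _ with fg a
  ... | b , e =
    let b<a = smono-reflect g mg b a (subst (λ z → toℕ z ℕ.< toℕ (g a)) e x)
        ih = agree m b (ℕP.<-≤-trans b<a (ℕ.s≤s⁻¹ lt))
    in ⊥-elim (ℕP.<-irrefl (cong toℕ (smono-inj f mf b a (trans ih (sym e)))) b<a)
  agree (suc m) a lt | tri> _ _ x with gf a
  ... | b , e =
    let b<a = smono-reflect f mf b a (subst (λ z → toℕ z ℕ.< toℕ (f a)) e x)
        ih = agree m b (ℕP.<-≤-trans b<a (ℕ.s≤s⁻¹ lt))
    in ⊥-elim (ℕP.<-irrefl (cong toℕ (smono-inj g mg b a (trans (sym ih) (sym e)))) b<a)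

monoTest : ∀ {k n} → (Fin k → Fin n) → Bool
monoTest f = allᶠ λ a → allᶠ λ b → not (a <ᶠ b) ∨ (f a <ᶠ f b)

monoTest-sound : ∀ {k n} (f : Fin k → Fin n) → T (monoTest f) → StrictMono f
monoTest-sound f h a b lt = <ᶠ-sound (⇒-elim (allᶠ-elim _ (allᶠ-elim _ h a) b) (<ᶠ-complete lt))

monoTest-complete : ∀ {k n} (f : Fin k → Fin n) → StrictMono f → T (monoTest f)
monoTest-complete f m = allᶠ-intro _ λ a → allᶠ-intro _ λ b → ⇒-intro λ lt → <ᶠ-complete (m a b (<ᶠ-sound lt))

ShufP : ∀ k l → Perm (k + l) → Set
ShufP k l ε = StrictMono (λ (a : Fin k) → lookup (inv ε) (a ↑ˡ l)) × StrictMono (λ (b : Fin l) → lookup (inv ε) (k ↑ʳ b))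

Sh-complete : ∀ k l (ε : Perm (k + l)) → IsPerm ε → ShufP k l ε → ε ∈ Sh k l
Sh-complete k l ε p (m₁ , m₂) =
  ∈-filterᵇ-intro (isShuffle k l) {Sym (k + l)} (Sym-complete ε p)
    (T-∧-intro (monoTest-complete _ m₁) (monoTest-complete _ m₂))

Sh-sound : ∀ k l {ε : Perm (k + l)} → ε ∈ Sh k l → IsPerm ε × ShufP k l ε
Sh-sound k l {ε} m with ∈-filterᵇ-elim (isShuffle k l) {Sym (k + l)} m
... | m₁ , q = Sym-sound m₁ , monoTest-sound _ (T-∧-l q)
                             , monoTest-sound _ (T-∧-r {monoTest (λ (a : Fin k) → lookup (inv ε) (a ↑ˡ l))} q)

Sh-unique : ∀ k l → Unique (Sh k l)
Sh-unique k l = uniq-filterᵇ (isShuffle k l) {Sym (k + l)} (Sym-unique (k + l))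

LeftOf : ∀ {k l} → Perm (k + l) → Fin (k + l) → Set
LeftOf {k} {l} ζ j = IsLeft {k} {l} (lookup ζ j)

-- A shuffle is determined by the set of positions it sends to the left
-- block: on each block its inverse is the increasing enumeration of the
-- corresponding set of positions.
shuffle-unique : ∀ {k l} (ε ε' : Perm (k + l)) → IsPerm ε → IsPerm ε' → ShufP k l ε → ShufP k l ε' →
  (∀ j → LeftOf ε j → LeftOf ε' j) → (∀ j → LeftOf ε' j → LeftOf ε j) → ε ≡ ε'
shuffle-unique {k} {l} ε ε' hε hε' (s₁ , s₂) (s₁' , s₂') LL' L'L =
  trans (sym (inv-inv ε hε)) (trans (cong inv (vec-ext inverses-agree)) (inv-inv ε' hε'))
  where
  right-to-right : ∀ (e₁ e₂ : Perm (k + l)) → (∀ j → LeftOf e₂ j → LeftOf e₁ j) →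
    ∀ j b → lookup e₁ j ≡ k ↑ʳ b → ∃[ b' ] lookup e₂ j ≡ k ↑ʳ b'
  right-to-right e₁ e₂ h j b e with splitEq k l (lookup e₂ j)
  ... | inj₂ r = r
  ... | inj₁ l' with h j l'
  ... | a , e' = ⊥-elim (↑ˡ≢↑ʳ _ _ (trans (sym e') e))
  leftAgree : ∀ a → lookup (inv ε) (a ↑ˡ l) ≡ lookup (inv ε') (a ↑ˡ l)
  leftAgree = smono-unique _ _ s₁ s₁'
    (λ a → let (a' , e) = LL' _ (a , σ-inv ε hε _) in a' , sym (inv-spec ε' hε' _ _ e))
    (λ a → let (a' , e) = L'L _ (a , σ-inv ε' hε' _) in a' , sym (inv-spec ε hε _ _ e))
  rightAgree : ∀ b → lookup (inv ε) (k ↑ʳ b) ≡ lookup (inv ε') (k ↑ʳ b)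
  rightAgree = smono-unique _ _ s₂ s₂'
    (λ b → let (b' , e) = right-to-right ε ε' L'L _ b (σ-inv ε hε _) in b' , sym (inv-spec ε' hε' _ _ e))
    (λ b → let (b' , e) = right-to-right ε' ε LL' _ b (σ-inv ε' hε' _) in b' , sym (inv-spec ε hε _ _ e))
  inverses-agree : ∀ j → lookup (inv ε) j ≡ lookup (inv ε') j
  inverses-agree j with split k l j
  ... | isL a = leftAgree a
  ... | isR b = rightAgree b

module Interleave {k l : ℕ} (f : Fin k → Fin (k + l)) (g : Fin l → Fin (k + l))
    (f-mono : StrictMono f) (g-mono : StrictMono g) (disjoint : ∀ a b → f a ≢ g b) where

  η : Perm (k + l)
  η = tabulate ([ f , g ]′ ∘ splitAt k)

  η-left : ∀ a → lookup η (a ↑ˡ l) ≡ f a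
  η-left a = trans (VecP.lookup∘tabulate _ (a ↑ˡ l)) (cong [ f , g ]′ (FinP.splitAt-↑ˡ k a l))

  η-right : ∀ b → lookup η (k ↑ʳ b) ≡ g b
  η-right b = trans (VecP.lookup∘tabulate _ (k ↑ʳ b)) (cong [ f , g ]′ (FinP.splitAt-↑ʳ k l b))

  η-perm : IsPerm η
  η-perm i j eq with split k l i | split k l j
  ... | isL a | isL a' = cong (_↑ˡ l) (smono-inj f f-mono a a' (trans (sym (η-left a)) (trans eq (η-left a'))))
  ... | isL a | isR b' = ⊥-elim (disjoint _ _ (trans (sym (η-left a)) (trans eq (η-right b'))))
  ... | isR b | isL a' = ⊥-elim (disjoint _ _ (trans (sym (η-left a')) (trans (sym eq) (η-right b))))
  ... | isR b | isR b' = cong (k ↑ʳ_) (smono-inj g g-mono b b' (trans (sym (η-right b)) (trans eq (η-right b'))))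

  ζ : Perm (k + l)
  ζ = inv η

  ζ-perm : IsPerm ζ
  ζ-perm = inv-perm η η-perm

  ζ-shuffle : ShufP k l ζ
  ζ-shuffle = (λ a b lt → subst (λ v → toℕ (lookup v (a ↑ˡ l)) ℕ.< toℕ (lookup v (b ↑ˡ l))) (sym (inv-inv η η-perm))
                 (subst₂ (λ u v → toℕ u ℕ.< toℕ v) (sym (η-left a)) (sym (η-left b)) (f-mono a b lt)))
            , (λ a b lt → subst (λ v → toℕ (lookup v (k ↑ʳ a)) ℕ.< toℕ (lookup v (k ↑ʳ b))) (sym (inv-inv η η-perm))
                 (subst₂ (λ u v → toℕ u ℕ.< toℕ v) (sym (η-right a)) (sym (η-right b)) (g-mono a b lt)))

  ζ-left : ∀ a → lookup ζ (f a) ≡ a ↑ˡ l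
  ζ-left a = inv-spec η η-perm (a ↑ˡ l) _ (η-left a)

  ζ-right : ∀ b → lookup ζ (g b) ≡ k ↑ʳ b
  ζ-right b = inv-spec η η-perm (k ↑ʳ b) _ (η-right b)

  ζ-left⁻ : ∀ j a → lookup ζ j ≡ a ↑ˡ l → j ≡ f a
  ζ-left⁻ j a e = trans (sym (inv-spec ζ ζ-perm j _ e)) (trans (cong (λ v → lookup v (a ↑ˡ l)) (inv-inv η η-perm)) (η-left a))

  ζ-right⁻ : ∀ j b → lookup ζ j ≡ k ↑ʳ b → j ≡ g b
  ζ-right⁻ j b e = trans (sym (inv-spec ζ ζ-perm j _ e)) (trans (cong (λ v → lookup v (k ↑ʳ b)) (inv-inv η η-perm)) (η-right b))

count-complement : ∀ {n} (S : Vec Bool n) → count S + count (Vec.map not S) ≡ n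
count-complement [] = refl
count-complement (true ∷ S) = cong suc (count-complement S)
count-complement (false ∷ S) = trans (ℕP.+-suc (count S) _) (cong suc (count-complement S))

lookup-not : ∀ {n} (S : Vec Bool n) i → lookup (Vec.map not S) i ≡ not (lookup S i)
lookup-not S i = VecP.lookup-map i not S

not-in-complement : ∀ {n} (S : Vec Bool n) i → T (lookup (Vec.map not S) i) → ¬ T (lookup S i)
not-in-complement S i h = T-not-elim (subst T (lookup-not S i) h)

in-complement : ∀ {n} (S : Vec Bool n) i → ¬ T (lookup S i) → T (lookup (Vec.map not S) i)
in-complement S i h = subst T (sym (lookup-not S i)) (T-not-intro h)

not-not-vec : ∀ {n} (S : Vec Bool n) → Vec.map not (Vec.map not S) ≡ S
not-not-vec [] = refl
not-not-vec (true ∷ S) = cong (true ∷_) (not-not-vec S)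
not-not-vec (false ∷ S) = cong (false ∷_) (not-not-vec S)

emb : ∀ {n} (S : Vec Bool n) → Fin (count S) → Fin n
emb (true ∷ S) zero = zero
emb (true ∷ S) (suc a) = suc (emb S a)
emb (false ∷ S) a = suc (emb S a)

emb-in : ∀ {n} (S : Vec Bool n) a → T (lookup S (emb S a))
emb-in (true ∷ S) zero = tt
emb-in (true ∷ S) (suc a) = emb-in S a
emb-in (false ∷ S) a = emb-in S a

emb-mono : ∀ {n} (S : Vec Bool n) → StrictMono (emb S)
emb-mono (true ∷ S) zero (suc b) lt = z<s
emb-mono (true ∷ S) (suc a) (suc b) (s<s lt) = s<s (emb-mono S a b lt)
emb-mono (false ∷ S) a b lt = s<s (emb-mono S a b lt)

emb-disjoint : ∀ {n} (S : Vec Bool n) a b → emb S a ≢ emb (Vec.map not S) b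
emb-disjoint S a b eq = not-in-complement S _ (emb-in (Vec.map not S) b) (subst (T ∘ lookup S) eq (emb-in S a))

rank-emb : ∀ {n} (S : Vec Bool n) a → rank S (emb S a) ≡ toℕ a
rank-emb (true ∷ S) zero = refl
rank-emb (true ∷ S) (suc a) = cong suc (rank-emb S a)
rank-emb (false ∷ S) a = rank-emb S a

rank-lt : ∀ {n} (S : Vec Bool n) i → T (lookup S i) → rank S i ℕ.< count S
rank-lt (true ∷ S) zero h = z<s
rank-lt (true ∷ S) (suc i) h = s<s (rank-lt S i h)
rank-lt (false ∷ S) (suc i) h = rank-lt S i h

emb-rank : ∀ {n} (S : Vec Bool n) i a → T (lookup S i) → toℕ a ≡ rank S i → emb S a ≡ i
emb-rank (true ∷ S) zero zero h eq = refl
emb-rank (true ∷ S) (suc i) (suc a) h eq = cong suc (emb-rank S i a h (ℕP.suc-injective eq))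
emb-rank (false ∷ S) (suc i) a h eq = cong suc (emb-rank S i a h eq)

rk : ∀ {n} (S : Vec Bool n) i → T (lookup S i) → Fin (count S)
rk S i h = Fin.fromℕ< (rank-lt S i h)

emb-rk : ∀ {n} (S : Vec Bool n) i h → emb S (rk S i h) ≡ i
emb-rk S i h = emb-rank S i (rk S i h) h (FinP.toℕ-fromℕ< (rank-lt S i h))

emb-inj : ∀ {n} (S : Vec Bool n) a b → emb S a ≡ emb S b → a ≡ b
emb-inj S a b eq = FinP.toℕ-injective (trans (sym (rank-emb S a)) (trans (cong (rank S) eq) (rank-emb S b)))

count-split : ∀ {n k l} (S : Vec Bool n) (f : Fin n → Fin n) → (∀ a b → f a ≡ f b → a ≡ b) →
  (∀ v → T (lookup S v) → toℕ (f v) ℕ.< k) → (∀ v → ¬ T (lookup S v) → k ℕ.≤ toℕ (f v)) → k + l ≡ n →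
  count S ≡ k × count (Vec.map not S) ≡ l
count-split {n} {k} {l} S f f-inj small large eq = count-S , count-S'
  where
  S' = Vec.map not S
  shifted : ∀ v → T (lookup S' v) → toℕ (f v) ∸ k ℕ.< l
  shifted v h = subst (toℕ (f v) ∸ k ℕ.<_) (ℕP.m+n∸m≡n k l)
    (ℕP.∸-monoˡ-< (subst (toℕ (f v) ℕ.<_) (sym eq) (FinP.toℕ<n (f v))) (large v (not-in-complement S v h)))
  S≤k : count S ℕ.≤ k
  S≤k = FinP.injective⇒≤ {f = into} into-inj
    where
    into : Fin (count S) → Fin k
    into a = Fin.fromℕ< (small (emb S a) (emb-in S a))
    into-inj : ∀ {a b} → into a ≡ into b → a ≡ b
    into-inj {a} {b} e = emb-inj S a b (f-inj _ _ (FinP.toℕ-injective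
      (trans (sym (FinP.toℕ-fromℕ< (small (emb S a) (emb-in S a))))
        (trans (cong toℕ e) (FinP.toℕ-fromℕ< (small (emb S b) (emb-in S b)))))))
  S'≤l : count S' ℕ.≤ l
  S'≤l = FinP.injective⇒≤ {f = into} into-inj
    where
    into : Fin (count S') → Fin l
    into a = Fin.fromℕ< (shifted (emb S' a) (emb-in S' a))
    large' : ∀ a → k ℕ.≤ toℕ (f (emb S' a))
    large' a = large _ (not-in-complement S _ (emb-in S' a))
    into-inj : ∀ {a b} → into a ≡ into b → a ≡ b
    into-inj {a} {b} e = emb-inj S' a b (f-inj _ _ (FinP.toℕ-injective
      (ℕP.∸-cancelʳ-≡ (large' a) (large' b)
        (trans (sym (FinP.toℕ-fromℕ< (shifted (emb S' a) (emb-in S' a))))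
          (trans (cong toℕ e) (FinP.toℕ-fromℕ< (shifted (emb S' b) (emb-in S' b))))))))
  total : count S + count S' ≡ k + l
  total = trans (count-complement S) (sym eq)
  count-S : count S ≡ k
  count-S = ℕP.≤-antisym S≤k (ℕP.+-cancelʳ-≤ l k (count S)
    (subst (ℕ._≤ count S + l) total (ℕP.+-monoʳ-≤ (count S) S'≤l)))
  count-S' : count S' ≡ l
  count-S' = ℕP.+-cancelˡ-≡ k _ _ (trans (cong (ℕ._+ count S') (sym count-S)) total)

toFin?-toℕ : ∀ {m} (b : Fin m) → toFin? m (toℕ b) ≡ just b
toFin?-toℕ {suc m} zero = refl
toFin?-toℕ {suc m} (suc b) = cong (Maybe.map suc) (toFin?-toℕ b)

toFin?-just : ∀ m x {b} → toFin? m x ≡ just b → toℕ b ≡ x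
toFin?-just (suc m) zero refl = refl
toFin?-just (suc m) (suc x) eq with toFin? m x in e
toFin?-just (suc m) (suc x) refl | just b = cong suc (toFin?-just m x e)

select-lookup : ∀ {A : Set} {n} (S : Vec Bool n) (v : Vec A n) a → lookup (select S v) a ≡ lookup v (emb S a)
select-lookup (true ∷ S) (x ∷ v) zero = refl
select-lookup (true ∷ S) (x ∷ v) (suc a) = select-lookup S v a
select-lookup (false ∷ S) (x ∷ v) a = select-lookup S v a

restrictedParent : ∀ {n} (S : Vec Bool n) → Maybe (Fin n) → Maybe (Fin (count S))
restrictedParent S p = p >>= λ q → if lookup S q then toFin? (count S) (rank S q) else nothing

restrict-lookup : ∀ {n} (S : Vec Bool n) (F : Forest n) a →
  lookup (restrict S F) a ≡ restrictedParent S (lookup F (emb S a))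
restrict-lookup S F a = trans (select-lookup S _ a) (VecP.lookup-map (emb S a) _ F)

restrict-parent⁺ : ∀ {n} (S : Vec Bool n) (F : Forest n) a q → lookup F (emb S a) ≡ just q →
  (h : T (lookup S q)) → lookup (restrict S F) a ≡ just (rk S q h)
restrict-parent⁺ S F a q e h rewrite restrict-lookup S F a | e =
  trans (cong (λ b → if b then toFin? (count S) (rank S q) else nothing) (Equivalence.to T-≡ h))
    (trans (cong (toFin? (count S)) (sym (FinP.toℕ-fromℕ< (rank-lt S q h)))) (toFin?-toℕ (rk S q h)))

restrict-parent⁻ : ∀ {n} (S : Vec Bool n) (F : Forest n) a b → lookup (restrict S F) a ≡ just b →
  lookup F (emb S a) ≡ just (emb S b)
restrict-parent⁻ S F a b e = parent (lookup F (emb S a)) refl (trans (sym (restrict-lookup S F a)) e)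
  where
  parent : ∀ p → lookup F (emb S a) ≡ p → restrictedParent S p ≡ just b → lookup F (emb S a) ≡ just (emb S b)
  parent (just q) e₁ e₂ with lookup S q in eS
  ... | true = trans e₁ (cong just (sym (emb-rank S q b (subst T (sym eS) tt) (toFin?-just (count S) (rank S q) e₂))))

-- Linear extensions.  σ ∈ S_F asks σ⁻¹ to decrease strictly from each vertex
-- to every vertex below it; by transitivity it is enough to ask this along
-- parent edges, which is the predicate `Resp F σ⁻¹`.

Resp : ∀ {n m} → Forest n → (Fin n → Fin m) → Set
Resp {n} F r = ∀ (i j : Fin n) → lookup F i ≡ just j → toℕ (r j) ℕ.< toℕ (r i)

Resp-path : ∀ {n m} (F : Forest n) (r : Fin n → Fin m) → Resp F r →
  ∀ k i j → iter F (suc k) i ≡ just j → toℕ (r j) ℕ.< toℕ (r i)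
Resp-path F r R zero i j e = R i j e
Resp-path F r R (suc k) i j e with iter F (suc k) i in e₁
... | just m = ℕP.<-trans (R m j e) (Resp-path F r R k i m e₁)

reach-sound : ∀ {n} (F : Forest n) i j → T (reach F i j) → ∃[ k ] iter F (suc k) i ≡ just j
reach-sound {n} F i j h with find (AnyP.any⁻ (λ k → iter F (suc k) i ==ₘ just j) (upTo n) h)
... | k , _ , q = k , ==ₘ-sound q

reach-complete : ∀ {n} (F : Forest n) i j k → k ℕ.< n → iter F (suc k) i ≡ just j → T (reach F i j)
reach-complete {n} F i j k lt e =
  AnyP.any⁺ (λ k → iter F (suc k) i ==ₘ just j)
    (lose (MemP.∈-upTo⁺ lt) (subst (λ x → T (x ==ₘ just j)) (sym e) (==ᶠ-complete {i = j} refl)))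

parent-reach : ∀ {n} (F : Forest n) i j → lookup F i ≡ just j → T (reach F i j)
parent-reach {suc n} F i j e = reach-complete F i j 0 z<s e

inS-sound : ∀ {n} (F : Forest n) (σ : Perm n) → T (inS F σ) → Resp F (lookup (inv σ))
inS-sound F σ h i j e = <ᶠ-sound (⇒-elim (allᶠ-elim _ (allᶠ-elim _ h i) j) (parent-reach F i j e))

inS-complete : ∀ {n} (F : Forest n) (σ : Perm n) → Resp F (lookup (inv σ)) → T (inS F σ)
inS-complete F σ R = allᶠ-intro _ λ i → allᶠ-intro _ λ j → ⇒-intro λ r →
  let (k , e) = reach-sound F i j r in <ᶠ-complete (Resp-path F (lookup (inv σ)) R k i j e)

Θ-complete : ∀ {n} (F : Forest n) (σ : Perm n) → IsPerm σ → Resp F (lookup (inv σ)) → σ ∈ Θ F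
Θ-complete {n} F σ p R = ∈-filterᵇ-intro (inS F) {Sym n} (Sym-complete σ p) (inS-complete F σ R)

Θ-sound : ∀ {n} (F : Forest n) {σ : Perm n} → σ ∈ Θ F → IsPerm σ × Resp F (lookup (inv σ))
Θ-sound {n} F {σ} m with ∈-filterᵇ-elim (inS F) {Sym n} m
... | m₁ , q = Sym-sound m₁ , inS-sound F σ q

Θ-unique : ∀ {n} (F : Forest n) → Unique (Θ F)
Θ-unique {n} F = uniq-filterᵇ (inS F) {Sym n} (Sym-unique n)

-- Resp only sees the relative order of the labels.
Resp-post⁺ : ∀ {n m m'} (F : Forest n) (r : Fin n → Fin m) (g : Fin m → Fin m') →
  StrictMono g → Resp F r → Resp F (g ∘ r)
Resp-post⁺ F r g mono R i j e = mono _ _ (R i j e)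

Resp-post⁻ : ∀ {n m m'} (F : Forest n) (r : Fin n → Fin m) (g : Fin m → Fin m') →
  StrictMono g → Resp F (g ∘ r) → Resp F r
Resp-post⁻ F r g mono R i j e = smono-reflect g mono _ _ (R i j e)

Resp-cong : ∀ {n m} (F : Forest n) {r r' : Fin n → Fin m} → (∀ i → r i ≡ r' i) → Resp F r → Resp F r'
Resp-cong F {r} {r'} eq R i j e = subst₂ (λ x y → toℕ x ℕ.< toℕ y) (eq j) (eq i) (R i j e)

lookup-·Fˡ : ∀ {k l} (F : Forest k) (G : Forest l) a → lookup (F ·F G) (a ↑ˡ l) ≡ Maybe.map (_↑ˡ l) (lookup F a)
lookup-·Fˡ {k} {l} F G a =
  trans (VecP.lookup-++ˡ (Vec.map (Maybe.map (_↑ˡ l)) F) (Vec.map (Maybe.map (k ↑ʳ_)) G) a) (VecP.lookup-map a _ F)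

lookup-·Fʳ : ∀ {k l} (F : Forest k) (G : Forest l) b → lookup (F ·F G) (k ↑ʳ b) ≡ Maybe.map (k ↑ʳ_) (lookup G b)
lookup-·Fʳ {k} {l} F G b =
  trans (VecP.lookup-++ʳ (Vec.map (Maybe.map (_↑ˡ l)) F) (Vec.map (Maybe.map (k ↑ʳ_)) G) b) (VecP.lookup-map b _ G)

Resp-·⁻ : ∀ {k l m} (F : Forest k) (G : Forest l) (r : Fin (k + l) → Fin m) →
  Resp (F ·F G) r → Resp F (r ∘ (_↑ˡ l)) × Resp G (r ∘ (k ↑ʳ_))
Resp-·⁻ {k} {l} F G r R =
  (λ i j e → R (i ↑ˡ l) (j ↑ˡ l) (trans (lookup-·Fˡ F G i) (cong (Maybe.map (_↑ˡ l)) e))) ,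
  (λ i j e → R (k ↑ʳ i) (k ↑ʳ j) (trans (lookup-·Fʳ F G i) (cong (Maybe.map (k ↑ʳ_)) e)))

map-just : ∀ {A B : Set} (f : A → B) (x : Maybe A) {y} → Maybe.map f x ≡ just y → ∃[ x' ] (x ≡ just x' × f x' ≡ y)
map-just f (just x) refl = x , refl , refl

Resp-·⁺ : ∀ {k l m} (F : Forest k) (G : Forest l) (r : Fin (k + l) → Fin m) →
  Resp F (r ∘ (_↑ˡ l)) → Resp G (r ∘ (k ↑ʳ_)) → Resp (F ·F G) r
Resp-·⁺ {k} {l} F G r RF RG i j e with split k l i
... | isL a with map-just (_↑ˡ l) (lookup F a) (trans (sym (lookup-·Fˡ F G a)) e)
...   | p , e₁ , refl = RF a p e₁
Resp-·⁺ {k} {l} F G r RF RG i j e | isR b with map-just (k ↑ʳ_) (lookup G b) (trans (sym (lookup-·Fʳ F G b)) e)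
...   | p , e₁ , refl = RG b p e₁

shuffled : ∀ {k l} → Perm k → Perm l → Perm (k + l) → Perm (k + l)
shuffled σ τ ε = (σ ⊗ₚ τ) ∘ₚ ε

shuffled-perm : ∀ {k l} (σ : Perm k) (τ : Perm l) (ε : Perm (k + l)) →
  IsPerm σ → IsPerm τ → IsPerm ε → IsPerm (shuffled σ τ ε)
shuffled-perm σ τ ε hσ hτ hε = ∘ₚ-perm (σ ⊗ₚ τ) ε (⊗ₚ-perm σ τ hσ hτ) hε

shuffled-inv-l : ∀ {k l} (σ : Perm k) (τ : Perm l) (ε : Perm (k + l)) → IsPerm σ → IsPerm τ → IsPerm ε →
  ∀ a → lookup (inv (shuffled σ τ ε)) (a ↑ˡ l) ≡ lookup (inv ε) (lookup (inv σ) a ↑ˡ l)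
shuffled-inv-l {k} {l} σ τ ε hσ hτ hε a =
  inv-spec (shuffled σ τ ε) (shuffled-perm σ τ ε hσ hτ hε) _ _ (begin
    lookup (shuffled σ τ ε) (lookup (inv ε) (lookup (inv σ) a ↑ˡ l))  ≡⟨ lookup-∘ₚ (σ ⊗ₚ τ) ε _ ⟩
    lookup (σ ⊗ₚ τ) (lookup ε (lookup (inv ε) (lookup (inv σ) a ↑ˡ l))) ≡⟨ cong (lookup (σ ⊗ₚ τ)) (σ-inv ε hε _) ⟩
    lookup (σ ⊗ₚ τ) (lookup (inv σ) a ↑ˡ l)                             ≡⟨ lookup-⊗ˡ σ τ _ ⟩
    lookup σ (lookup (inv σ) a) ↑ˡ l                                    ≡⟨ cong (_↑ˡ l) (σ-inv σ hσ a) ⟩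
    a ↑ˡ l                                                              ∎)
  where open ≡-Reasoning

shuffled-inv-r : ∀ {k l} (σ : Perm k) (τ : Perm l) (ε : Perm (k + l)) → IsPerm σ → IsPerm τ → IsPerm ε →
  ∀ b → lookup (inv (shuffled σ τ ε)) (k ↑ʳ b) ≡ lookup (inv ε) (k ↑ʳ lookup (inv τ) b)
shuffled-inv-r {k} {l} σ τ ε hσ hτ hε b =
  inv-spec (shuffled σ τ ε) (shuffled-perm σ τ ε hσ hτ hε) _ _ (begin
    lookup (shuffled σ τ ε) (lookup (inv ε) (k ↑ʳ lookup (inv τ) b))  ≡⟨ lookup-∘ₚ (σ ⊗ₚ τ) ε _ ⟩
    lookup (σ ⊗ₚ τ) (lookup ε (lookup (inv ε) (k ↑ʳ lookup (inv τ) b))) ≡⟨ cong (lookup (σ ⊗ₚ τ)) (σ-inv ε hε _) ⟩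
    lookup (σ ⊗ₚ τ) (k ↑ʳ lookup (inv τ) b)                             ≡⟨ lookup-⊗ʳ σ τ _ ⟩
    k ↑ʳ lookup τ (lookup (inv τ) b)                                    ≡⟨ cong (k ↑ʳ_) (σ-inv τ hτ b) ⟩
    k ↑ʳ b                                                              ∎)
  where open ≡-Reasoning

⊗ₚ-injective : ∀ {k l} (σ σ' : Perm k) (τ τ' : Perm l) →
  (∀ j → lookup (σ ⊗ₚ τ) j ≡ lookup (σ' ⊗ₚ τ') j) → σ ≡ σ' × τ ≡ τ'
⊗ₚ-injective {k} {l} σ σ' τ τ' agree =
  vec-ext (λ a → FinP.↑ˡ-injective l _ _ (trans (sym (lookup-⊗ˡ σ τ a)) (trans (agree _) (lookup-⊗ˡ σ' τ' a)))) ,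
  vec-ext (λ b → FinP.↑ʳ-injective k _ _ (trans (sym (lookup-⊗ʳ σ τ b)) (trans (agree _) (lookup-⊗ʳ σ' τ' b))))

-- A shuffle product determines its factors and its shuffle: the shuffle is
-- recovered from the positions holding values of the left block.
shuffled-injective : ∀ {k l} (σ σ' : Perm k) (τ τ' : Perm l) (ε ε' : Perm (k + l)) →
  IsPerm ε → IsPerm ε' → ShufP k l ε → ShufP k l ε' →
  shuffled σ τ ε ≡ shuffled σ' τ' ε' → σ ≡ σ' × τ ≡ τ' × ε ≡ ε'
shuffled-injective {k} {l} σ σ' τ τ' ε ε' hε hε' sh sh' eq =
  let (σ≡ , τ≡) = ⊗ₚ-injective σ σ' τ τ' tensors-agree in σ≡ , τ≡ , ε≡
  where
  at : ∀ i → lookup (σ ⊗ₚ τ) (lookup ε i) ≡ lookup (σ' ⊗ₚ τ') (lookup ε' i)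
  at i = trans (sym (lookup-∘ₚ (σ ⊗ₚ τ) ε i)) (trans (cong (λ v → lookup v i) eq) (lookup-∘ₚ (σ' ⊗ₚ τ') ε' i))
  ε≡ : ε ≡ ε'
  ε≡ = shuffle-unique ε ε' hε hε' sh sh'
    (λ j L → ⊗-left⁻ σ' τ' _ (subst (IsLeft {k} {l}) (at j) (⊗-left⁺ σ τ _ L)))
    (λ j L → ⊗-left⁻ σ τ _ (subst (IsLeft {k} {l}) (sym (at j)) (⊗-left⁺ σ' τ' _ L)))
  tensors-agree : ∀ j → lookup (σ ⊗ₚ τ) j ≡ lookup (σ' ⊗ₚ τ') j
  tensors-agree j with perm-surj ε hε j
  ... | i , refl = trans (at i) (cong (λ v → lookup (σ' ⊗ₚ τ') (lookup v i)) (sym ε≡))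

-- Every permutation x of k + l is a shuffle product: ε lists first, in
-- order, the positions where x takes values below k.
module Decompose {k l : ℕ} (x : Perm (k + l)) (hx : IsPerm x) where

  S : Vec Bool (k + l)
  S = tabulate (λ i → toℕ (lookup x i) ℕ.<ᵇ k)

  S' : Vec Bool (k + l)
  S' = Vec.map not S

  S-small : ∀ i → T (lookup S i) → toℕ (lookup x i) ℕ.< k
  S-small i h = ℕP.<ᵇ⇒< _ _ (subst T (VecP.lookup∘tabulate _ i) h)

  S-large : ∀ i → ¬ T (lookup S i) → k ℕ.≤ toℕ (lookup x i)
  S-large i h = ℕP.≮⇒≥ λ lt → h (subst T (sym (VecP.lookup∘tabulate _ i)) (ℕP.<⇒<ᵇ lt))

  counts : count S ≡ k × count S' ≡ l
  counts = count-split S (lookup x) hx S-small S-large refl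

  f : Fin k → Fin (k + l)
  f a = emb S (Fin.cast (sym (proj₁ counts)) a)

  g : Fin l → Fin (k + l)
  g b = emb S' (Fin.cast (sym (proj₂ counts)) b)

  f-mono : StrictMono f
  f-mono a b lt = emb-mono S _ _ (cast-mono (sym (proj₁ counts)) a b lt)

  g-mono : StrictMono g
  g-mono a b lt = emb-mono S' _ _ (cast-mono (sym (proj₂ counts)) a b lt)

  open Interleave f g f-mono g-mono (λ a b → emb-disjoint S _ _) public

  x-f : ∀ a → toℕ (lookup x (f a)) ℕ.< k
  x-f a = S-small _ (emb-in S _)

  x-g : ∀ b → k ℕ.≤ toℕ (lookup x (g b))
  x-g b = S-large _ (not-in-complement S _ (emb-in S' _))

  x-g-bound : ∀ b → toℕ (lookup x (g b)) ∸ k ℕ.< l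
  x-g-bound b = ℕP.+-cancelˡ-< k _ _ (subst₂ ℕ._<_ (sym (ℕP.m+[n∸m]≡n (x-g b))) refl (FinP.toℕ<n (lookup x (g b))))

  -- σ and τ are the standardisations of x on S and on its complement
  σ : Perm k
  σ = tabulate (λ a → Fin.fromℕ< (x-f a))

  τ : Perm l
  τ = tabulate (λ b → Fin.fromℕ< (x-g-bound b))

  toℕ-σ : ∀ a → toℕ (lookup σ a) ≡ toℕ (lookup x (f a))
  toℕ-σ a = trans (cong toℕ (VecP.lookup∘tabulate _ a)) (FinP.toℕ-fromℕ< (x-f a))

  toℕ-τ : ∀ b → k + toℕ (lookup τ b) ≡ toℕ (lookup x (g b))
  toℕ-τ b = trans (cong (λ z → k + toℕ z) (VecP.lookup∘tabulate _ b))
                  (trans (cong (k +_) (FinP.toℕ-fromℕ< (x-g-bound b))) (ℕP.m+[n∸m]≡n (x-g b)))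

  σ-perm : IsPerm σ
  σ-perm a a' eq = smono-inj f f-mono a a'
    (hx _ _ (FinP.toℕ-injective (trans (sym (toℕ-σ a)) (trans (cong toℕ eq) (toℕ-σ a')))))

  τ-perm : IsPerm τ
  τ-perm b b' eq = smono-inj g g-mono b b'
    (hx _ _ (FinP.toℕ-injective (trans (sym (toℕ-τ b)) (trans (cong (λ z → k + toℕ z) eq) (toℕ-τ b')))))

  decomposes : shuffled σ τ ζ ≡ x
  decomposes = vec-ext λ i → trans (lookup-∘ₚ (σ ⊗ₚ τ) ζ i) (at i (splitEq k l (lookup ζ i)))
    where
    at : ∀ i → (∃[ a ] lookup ζ i ≡ a ↑ˡ l) ⊎ (∃[ b ] lookup ζ i ≡ k ↑ʳ b) → lookup (σ ⊗ₚ τ) (lookup ζ i) ≡ lookup x i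
    at i (inj₁ (a , e)) = FinP.toℕ-injective (begin
      toℕ (lookup (σ ⊗ₚ τ) (lookup ζ i)) ≡⟨ cong (toℕ ∘ lookup (σ ⊗ₚ τ)) e ⟩
      toℕ (lookup (σ ⊗ₚ τ) (a ↑ˡ l))     ≡⟨ cong toℕ (lookup-⊗ˡ σ τ a) ⟩
      toℕ (lookup σ a ↑ˡ l)              ≡⟨ FinP.toℕ-↑ˡ (lookup σ a) l ⟩
      toℕ (lookup σ a)                   ≡⟨ toℕ-σ a ⟩
      toℕ (lookup x (f a))               ≡⟨ cong (toℕ ∘ lookup x) (sym (ζ-left⁻ i a e)) ⟩
      toℕ (lookup x i)                   ∎)
      where open ≡-Reasoning
    at i (inj₂ (b , e)) = FinP.toℕ-injective (begin
      toℕ (lookup (σ ⊗ₚ τ) (lookup ζ i)) ≡⟨ cong (toℕ ∘ lookup (σ ⊗ₚ τ)) e ⟩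
      toℕ (lookup (σ ⊗ₚ τ) (k ↑ʳ b))     ≡⟨ cong toℕ (lookup-⊗ʳ σ τ b) ⟩
      toℕ (k ↑ʳ lookup τ b)              ≡⟨ FinP.toℕ-↑ʳ k (lookup τ b) ⟩
      k + toℕ (lookup τ b)               ≡⟨ toℕ-τ b ⟩
      toℕ (lookup x (g b))               ≡⟨ cong (toℕ ∘ lookup x) (sym (ζ-right⁻ i b e)) ⟩
      toℕ (lookup x i)                   ∎)
      where open ≡-Reasoning

decompose : ∀ {k l} (x : Perm (k + l)) → IsPerm x →
  ∃[ σ ] ∃[ τ ] ∃[ ε ] (IsPerm σ × IsPerm τ × IsPerm ε × ShufP k l ε × shuffled σ τ ε ≡ x)
decompose {k} {l} x hx = σ , τ , ζ , σ-perm , τ-perm , ζ-perm , ζ-shuffle , decomposes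
  where open Decompose {k} {l} x hx

mulFQ-elim : ∀ {k l} (A : List (Perm k)) (B : List (Perm l)) {z} → z ∈ mulFQ A B →
  ∃[ σ ] ∃[ τ ] ∃[ ε ] (σ ∈ A × τ ∈ B × ε ∈ Sh k l × z ≡ shuffled σ τ ε)
mulFQ-elim {k} {l} A B z∈ with ∈-concatMap-elim (λ σ → concatMap (λ τ → mulP σ τ) B) A z∈
... | σ , σ∈ , z∈' with ∈-concatMap-elim (λ τ → mulP σ τ) B z∈'
... | τ , τ∈ , z∈'' with MemP.∈-map⁻ (shuffled σ τ) z∈''
... | ε , ε∈ , eq = σ , τ , ε , σ∈ , τ∈ , ε∈ , eq

mulFQ-intro : ∀ {k l} (A : List (Perm k)) (B : List (Perm l)) {σ τ ε} →
  σ ∈ A → τ ∈ B → ε ∈ Sh k l → shuffled σ τ ε ∈ mulFQ A B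
mulFQ-intro {k} {l} A B {σ} {τ} {ε} σ∈ τ∈ ε∈ =
  ∈-concatMap-intro (λ σ → concatMap (λ τ → mulP σ τ) B) σ∈
    (∈-concatMap-intro (λ τ → mulP σ τ) τ∈ (MemP.∈-map⁺ (shuffled σ τ) ε∈))

mulFQ-unique : ∀ {k l} (A : List (Perm k)) (B : List (Perm l)) → Unique A → Unique B → Unique (mulFQ A B)
mulFQ-unique {k} {l} A B uA uB =
  uniq-concatMap (λ σ → concatMap (λ τ → mulP σ τ) B) A uA
    (λ σ _ → uniq-concatMap (λ τ → mulP σ τ) B uB
       (λ τ _ → uniq-map (shuffled σ τ) (Sh k l) (Sh-unique k l)
          (λ ε ε' ε∈ ε'∈ eq → proj₂ (proj₂ (injective σ σ τ τ ε∈ ε'∈ eq))))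
       (λ τ τ' z _ _ z∈ z∈' → second-factor {σ} z∈ z∈'))
    (λ σ σ' z _ _ z∈ z∈' → first-factor {σ} {σ'} z∈ z∈')
  where
  injective : ∀ σ σ' τ τ' {ε ε'} → ε ∈ Sh k l → ε' ∈ Sh k l → shuffled σ τ ε ≡ shuffled σ' τ' ε' →
    σ ≡ σ' × τ ≡ τ' × ε ≡ ε'
  injective σ σ' τ τ' {ε} {ε'} ε∈ ε'∈ =
    let (hε , sε) = Sh-sound k l ε∈ ; (hε' , sε') = Sh-sound k l ε'∈ in
    shuffled-injective σ σ' τ τ' ε ε' hε hε' sε sε'
  second-factor : ∀ {σ τ τ' z} → z ∈ mulP σ τ → z ∈ mulP σ τ' → τ ≡ τ'
  second-factor {σ} {τ} {τ'} z∈ z∈' with MemP.∈-map⁻ (shuffled σ τ) z∈ | MemP.∈-map⁻ (shuffled σ τ') z∈'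
  ... | ε , ε∈ , refl | ε' , ε'∈ , eq = proj₁ (proj₂ (injective σ σ τ τ' ε∈ ε'∈ eq))
  first-factor : ∀ {σ σ' z} → z ∈ concatMap (λ τ → mulP σ τ) B → z ∈ concatMap (λ τ → mulP σ' τ) B → σ ≡ σ'
  first-factor {σ} {σ'} z∈ z∈' with ∈-concatMap-elim (λ τ → mulP σ τ) B z∈ | ∈-concatMap-elim (λ τ → mulP σ' τ) B z∈'
  ... | τ , _ , m | τ' , _ , m' with MemP.∈-map⁻ (shuffled σ τ) m | MemP.∈-map⁻ (shuffled σ' τ') m'
  ... | ε , ε∈ , refl | ε' , ε'∈ , eq = proj₁ (injective σ σ' τ τ' ε∈ ε'∈ eq)

-- The core of the product formula: a shuffle product is a linear extension
-- of F · G iff its factors are linear extensions of F and of G, because on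
-- each block its inverse is the factor's inverse followed by an increasing
-- map.
module _ {k l : ℕ} (F : Forest k) (G : Forest l) (σ : Perm k) (τ : Perm l) (ε : Perm (k + l))
         (hσ : IsPerm σ) (hτ : IsPerm τ) (hε : IsPerm ε) (sh : ShufP k l ε) where

  private
    left : Fin k → Fin (k + l)
    left a = lookup (inv ε) (a ↑ˡ l)
    right : Fin l → Fin (k + l)
    right b = lookup (inv ε) (k ↑ʳ b)

  Resp-shuffled⁺ : Resp F (lookup (inv σ)) → Resp G (lookup (inv τ)) → Resp (F ·F G) (lookup (inv (shuffled σ τ ε)))
  Resp-shuffled⁺ RF RG = Resp-·⁺ F G _
    (Resp-cong F (λ a → sym (shuffled-inv-l σ τ ε hσ hτ hε a)) (Resp-post⁺ F (lookup (inv σ)) left (proj₁ sh) RF))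
    (Resp-cong G (λ b → sym (shuffled-inv-r σ τ ε hσ hτ hε b)) (Resp-post⁺ G (lookup (inv τ)) right (proj₂ sh) RG))

  Resp-shuffled⁻ : Resp (F ·F G) (lookup (inv (shuffled σ τ ε))) → Resp F (lookup (inv σ)) × Resp G (lookup (inv τ))
  Resp-shuffled⁻ R = let (RF , RG) = Resp-·⁻ F G _ R in
    Resp-post⁻ F (lookup (inv σ)) left (proj₁ sh) (Resp-cong F (shuffled-inv-l σ τ ε hσ hτ hε) RF) ,
    Resp-post⁻ G (lookup (inv τ)) right (proj₂ sh) (Resp-cong G (shuffled-inv-r σ τ ε hσ hτ hε) RG)

Θ-product : ∀ {k l} (F : Forest k) (G : Forest l) → Θ (F ·F G) ↭ mulFQ (Θ F) (Θ G)
Θ-product {k} {l} F G =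
  uniq-set-↭ (Θ-unique (F ·F G)) (mulFQ-unique (Θ F) (Θ G) (Θ-unique F) (Θ-unique G)) Θ⊆mul mul⊆Θ
  where
  factors : ∀ {x} → IsPerm x × Resp (F ·F G) (lookup (inv x)) →
    (∃[ σ ] ∃[ τ ] ∃[ ε ] (IsPerm σ × IsPerm τ × IsPerm ε × ShufP k l ε × shuffled σ τ ε ≡ x)) →
    x ∈ mulFQ (Θ F) (Θ G)
  factors (_ , R) (σ , τ , ε , hσ , hτ , hε , sh , refl) =
    let (RF , RG) = Resp-shuffled⁻ F G σ τ ε hσ hτ hε sh R in
    mulFQ-intro (Θ F) (Θ G) (Θ-complete F σ hσ RF) (Θ-complete G τ hτ RG) (Sh-complete k l ε hε sh)
  Θ⊆mul : ∀ x → x ∈ Θ (F ·F G) → x ∈ mulFQ (Θ F) (Θ G)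
  Θ⊆mul x x∈ = factors (Θ-sound (F ·F G) x∈) (decompose x (proj₁ (Θ-sound (F ·F G) x∈)))
  product : ∀ {x} → (∃[ σ ] ∃[ τ ] ∃[ ε ] (σ ∈ Θ F × τ ∈ Θ G × ε ∈ Sh k l × x ≡ shuffled σ τ ε)) → x ∈ Θ (F ·F G)
  product (σ , τ , ε , σ∈ , τ∈ , ε∈ , refl) =
    let (hσ , RF) = Θ-sound F σ∈ ; (hτ , RG) = Θ-sound G τ∈ ; (hε , sh) = Sh-sound k l ε∈ in
    Θ-complete (F ·F G) (shuffled σ τ ε) (shuffled-perm σ τ ε hσ hτ hε) (Resp-shuffled⁺ F G σ τ ε hσ hτ hε sh RF RG)
  mul⊆Θ : ∀ x → x ∈ mulFQ (Θ F) (Θ G) → x ∈ Θ (F ·F G)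
  mul⊆Θ x x∈ = product (mulFQ-elim (Θ F) (Θ G) x∈)

-- Reachability and cuts in a forest.  `IsForest F` says every vertex
-- reaches a root within n steps; then the bounded test `reach` of Defs is
-- unbounded reachability, which has no cycles.  Admissible cuts c
-- correspond bijectively to their leaf sets `leaSet F c`: these are the
-- upward closed sets L (closed under passing to children), and c is
-- recovered from L as the members of L whose parent lies outside L.
module ForestCuts {n : ℕ} (F : Forest n) (hF : IsForest F) where

  Reach : Fin n → Fin n → Set
  Reach i j = ∃[ k ] iter F (suc k) i ≡ just j

  >>=-just : ∀ {A : Set} (m : Maybe A) → (m >>= just) ≡ m
  >>=-just (just x) = refl
  >>=-just nothing = refl

  >>=-assoc : ∀ {A B C : Set} (m : Maybe A) (f : A → Maybe B) (g : B → Maybe C) →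
    ((m >>= f) >>= g) ≡ (m >>= λ x → f x >>= g)
  >>=-assoc (just x) f g = refl
  >>=-assoc nothing f g = refl

  iter-shift : ∀ k i → iter F (suc k) i ≡ (lookup F i >>= iter F k)
  iter-shift zero i = sym (>>=-just (lookup F i))
  iter-shift (suc k) i = trans (cong (_>>= lookup F) (iter-shift k i)) (>>=-assoc (lookup F i) (iter F k) (lookup F))

  iter-add : ∀ a b i → iter F (b + a) i ≡ (iter F a i >>= iter F b)
  iter-add a zero i = sym (>>=-just (iter F a i))
  iter-add a (suc b) i = trans (cong (_>>= lookup F) (iter-add a b i)) (>>=-assoc (iter F a i) (iter F b) (lookup F))

  iter-beyond : ∀ d i → n ℕ.≤ d → iter F d i ≡ nothing
  iter-beyond d i le = subst (λ m → iter F m i ≡ nothing) (ℕP.m∸n+n≡m le)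
    (trans (iter-add n (d ∸ n) i) (cong (_>>= iter F (d ∸ n)) (hF i)))

  Reach⇒reach : ∀ i j → Reach i j → T (reach F i j)
  Reach⇒reach i j (k , e) with k ℕ.<? n
  ... | yes k<n = reach-complete F i j k k<n e
  ... | no k≮n = ⊥-elim (nothing≢just (trans (sym (iter-beyond (suc k) i (ℕP.≤-trans (ℕP.≮⇒≥ k≮n) (ℕP.n≤1+n k)))) e))

  reach⇒Reach : ∀ i j → T (reach F i j) → Reach i j
  reach⇒Reach i j h = reach-sound F i j h

  Reach-cons : ∀ w p v → lookup F w ≡ just p → Reach p v → Reach w v
  Reach-cons w p v e (k , r) = suc k , trans (iter-shift (suc k) w) (trans (cong (_>>= iter F (suc k)) e) r)

  Reach-tail : ∀ k w v p → iter F (suc (suc k)) w ≡ just v → lookup F w ≡ just p → iter F (suc k) p ≡ just v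
  Reach-tail k w v p e ep = trans (sym (cong (_>>= iter F (suc k)) ep)) (trans (sym (iter-shift (suc k) w)) e)

  Reach-step : ∀ w v p → Reach w v → lookup F w ≡ just p → p ≡ v ⊎ Reach p v
  Reach-step w v p (zero , e) ep = inj₁ (just-injective (trans (sym ep) e))
  Reach-step w v p (suc k , e) ep = inj₂ (k , Reach-tail k w v p e ep)

  root-Reach : ∀ w v → lookup F w ≡ nothing → ¬ Reach w v
  root-Reach w v e (k , r) = nothing≢just (trans (sym (trans (iter-shift k w) (cong (_>>= iter F k) e))) r)

  no-cycle : ∀ i → ¬ Reach i i
  no-cycle i (k , e) = nothing≢just (trans (sym (iter-beyond (n ℕ.* suc k) i (ℕP.m≤m*n n (suc k)))) (periodic n))
    where
    periodic : ∀ m → iter F (m ℕ.* suc k) i ≡ just i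
    periodic zero = refl
    periodic (suc m) = trans (iter-add (m ℕ.* suc k) (suc k) i) (trans (cong (_>>= iter F (suc k)) (periodic m)) e)

  UpC : Vec Bool n → Set
  UpC L = ∀ v p → lookup F v ≡ just p → T (lookup L p) → T (lookup L v)

  UpC-reach : ∀ L → UpC L → ∀ w v → Reach w v → T (lookup L v) → T (lookup L w)
  UpC-reach L up w v (k , e) h = along k w e
    where
    along : ∀ k w → iter F (suc k) w ≡ just v → T (lookup L w)
    along zero w e = up w v e h
    along (suc k) w e = via (lookup F w) refl
      where
      via : ∀ m → lookup F w ≡ m → T (lookup L w)
      via nothing ep = ⊥-elim (root-Reach w v ep (suc k , e))
      via (just p) ep = up w p ep (along k p (Reach-tail k w v p e ep))

  lea-lookup : ∀ c w → lookup (leaSet F c) w ≡ (lookup c w ∨ anyᶠ (λ v → lookup c v ∧ reach F w v))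
  lea-lookup c w = VecP.lookup∘tabulate _ w

  lea-in : ∀ c w → T (lookup c w) → T (lookup (leaSet F c) w)
  lea-in c w h = subst T (sym (lea-lookup c w)) (T-∨-l h)

  lea-reach : ∀ c w v → T (lookup c v) → Reach w v → T (lookup (leaSet F c) w)
  lea-reach c w v h r = subst T (sym (lea-lookup c w)) (T-∨-r {lookup c w}
    (anyᶠ-intro (λ v → lookup c v ∧ reach F w v) v (T-∧-intro h (Reach⇒reach w v r))))

  lea-elim : ∀ c w → T (lookup (leaSet F c) w) → T (lookup c w) ⊎ ∃[ v ] (T (lookup c v) × Reach w v)
  lea-elim c w h with T-∨-elim {lookup c w} (subst T (lea-lookup c w) h)
  ... | inj₁ q = inj₁ q
  ... | inj₂ q with anyᶠ-elim (λ v → lookup c v ∧ reach F w v) q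
  ... | v , q' = inj₂ (v , T-∧-l q' , reach⇒Reach w v (T-∧-r {lookup c v} q'))

  lea-up : ∀ c → UpC (leaSet F c)
  lea-up c v p e h with lea-elim c p h
  ... | inj₁ q = lea-reach c v p q (0 , e)
  ... | inj₂ (u , q , r) = lea-reach c v u q (Reach-cons v p u e r)

  adm-elim : ∀ c → T (admissible F c) → ∀ v w → T (lookup c v) → T (lookup c w) → v ≢ w → ¬ Reach v w
  adm-elim c h v w cv cw ne r =
    T-not-elim (allᶠ-elim _ (allᶠ-elim _ h v) w)
      (T-∧-intro cv (T-∧-intro cw (T-∧-intro (T-not-intro (λ q → ne (==ᶠ-sound q))) (Reach⇒reach v w r))))

  adm-intro : ∀ c → (∀ v w → T (lookup c v) → T (lookup c w) → ¬ Reach v w) → T (admissible F c)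
  adm-intro c h = allᶠ-intro _ λ v → allᶠ-intro _ λ w → T-not-intro λ q →
    h v w (T-∧-l q) (T-∧-l (T-∧-r {lookup c v} q))
      (reach⇒Reach v w (T-∧-r {not (v ==ᶠ w)} (T-∧-r {lookup c w} (T-∧-r {lookup c v} q))))

  parentIn : Vec Bool n → Fin n → Bool
  parentIn L v = Maybe.maybe (lookup L) false (lookup F v)

  cutOf : Vec Bool n → Vec Bool n
  cutOf L = tabulate (λ v → lookup L v ∧ not (parentIn L v))

  cut-lookup : ∀ L v → lookup (cutOf L) v ≡ (lookup L v ∧ not (parentIn L v))
  cut-lookup L v = VecP.lookup∘tabulate _ v

  cut-sub : ∀ L v → T (lookup (cutOf L) v) → T (lookup L v)
  cut-sub L v h = T-∧-l (subst T (cut-lookup L v) h)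

  cut-parent : ∀ L v p → T (lookup (cutOf L) v) → lookup F v ≡ just p → ¬ T (lookup L p)
  cut-parent L v p h e q =
    T-not-elim (T-∧-r {lookup L v} (subst T (cut-lookup L v) h)) (subst (T ∘ Maybe.maybe (lookup L) false) (sym e) q)

  cut-intro : ∀ L v → T (lookup L v) → (∀ p → lookup F v ≡ just p → ¬ T (lookup L p)) → T (lookup (cutOf L) v)
  cut-intro L v h np = subst T (sym (cut-lookup L v)) (T-∧-intro h (T-not-intro (parent-out (lookup F v) refl)))
    where
    parent-out : ∀ m → lookup F v ≡ m → ¬ T (Maybe.maybe (lookup L) false m)
    parent-out (just p) e q = np p e q

  cut-adm : ∀ L → UpC L → T (admissible F (cutOf L))
  cut-adm L up = adm-intro (cutOf L) λ v w cv cw r → blocked v w cv cw r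
    where
    blocked : ∀ v w → T (lookup (cutOf L) v) → T (lookup (cutOf L) w) → ¬ Reach v w
    blocked v w cv cw r with lookup F v in e
    ... | nothing = root-Reach v w e r
    ... | just p with Reach-step v w p r e
    ...   | inj₁ refl = cut-parent L v p cv e (cut-sub L p cw)
    ...   | inj₂ r' = cut-parent L v p cv e (UpC-reach L up p w r' (cut-sub L w cw))

  toward-cut : ∀ L m v → T (lookup L v) → iter F m v ≡ nothing →
    T (lookup (cutOf L) v) ⊎ ∃[ u ] (T (lookup (cutOf L) u) × Reach v u)
  toward-cut L (suc m) v h e with lookup F v in ep
  ... | nothing = inj₁ (cut-intro L v h λ p e' → ⊥-elim (nothing≢just (trans (sym ep) e')))
  ... | just p with T-dec (lookup L p)
  ...   | inj₂ np = inj₁ (cut-intro L v h λ p' e' → subst (¬_ ∘ T ∘ lookup L) (just-injective (trans (sym ep) e')) (T-not-elim np))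
  ...   | inj₁ hp with toward-cut L m p hp (trans (sym (cong (_>>= iter F m) ep)) (trans (sym (iter-shift m v)) e))
  ...     | inj₁ q = inj₂ (p , q , (0 , ep))
  ...     | inj₂ (u , q , r) = inj₂ (u , q , Reach-cons v p u ep r)

  cut-lea : ∀ L → UpC L → leaSet F (cutOf L) ≡ L
  cut-lea L up = vec-ext λ v → T-ext (to v) (from v)
    where
    to : ∀ v → T (lookup (leaSet F (cutOf L)) v) → T (lookup L v)
    to v h with lea-elim (cutOf L) v h
    ... | inj₁ q = cut-sub L v q
    ... | inj₂ (u , q , r) = UpC-reach L up v u r (cut-sub L u q)
    from : ∀ v → T (lookup L v) → T (lookup (leaSet F (cutOf L)) v)
    from v h with toward-cut L n v h (hF v)
    ... | inj₁ q = lea-in (cutOf L) v q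
    ... | inj₂ (u , q , r) = lea-reach (cutOf L) v u q r

  lea-cut : ∀ c → T (admissible F c) → cutOf (leaSet F c) ≡ c
  lea-cut c adm = vec-ext λ v → T-ext (to v) (from v)
    where
    L = leaSet F c
    to : ∀ v → T (lookup (cutOf L) v) → T (lookup c v)
    to v h with lea-elim c v (cut-sub L v h)
    ... | inj₁ q = q
    ... | inj₂ (u , q , r) with lookup F v in ep
    ...   | nothing = ⊥-elim (root-Reach v u ep r)
    ...   | just p with Reach-step v u p r ep
    ...     | inj₁ refl = ⊥-elim (cut-parent L v p h ep (lea-in c p q))
    ...     | inj₂ r' = ⊥-elim (cut-parent L v p h ep (lea-reach c p u q r'))
    acyclic : ∀ v u → Reach v u → v ≢ u
    acyclic v u r refl = no-cycle v r
    from : ∀ v → T (lookup c v) → T (lookup (cutOf L) v)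
    from v h = cut-intro L v (lea-in c v h) parent-out
      where
      parent-out : ∀ p → lookup F v ≡ just p → ¬ T (lookup L p)
      parent-out p ep q with lea-elim c p q
      ... | inj₁ q' = adm-elim c adm v p h q' (acyclic v p (0 , ep)) (0 , ep)
      ... | inj₂ (u , q' , r) = adm-elim c adm v u h q' (acyclic v u (Reach-cons v p u ep r)) (Reach-cons v p u ep r)

  lea-inj : ∀ c c' → T (admissible F c) → T (admissible F c') → leaSet F c ≡ leaSet F c' → c ≡ c'
  lea-inj c c' a a' eq = trans (sym (lea-cut c a)) (trans (cong cutOf eq) (lea-cut c' a'))

-- The k-th summand of ΔP σ lists the triples
-- (ζ, σ₁, σ₂) with ζ ∈ Sh(k, l) and σ = ζ⁻¹ ∘ (σ₁ ⊗ σ₂); as k + l is only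
-- propositionally n, this equation is compared on words of naturals.

Valid : ∀ {n k l} → Perm n → Perm (k + l) → Perm k → Perm l → Set
Valid σ ζ σ₁ σ₂ = word σ ≡ word (inv ζ ∘ₚ (σ₁ ⊗ₚ σ₂))

word⇒pointwise : ∀ {a b n m} (v : Vec (Fin a) n) (w : Vec (Fin b) m) (e : n ≡ m) → word v ≡ word w →
  ∀ i → toℕ (lookup v i) ≡ toℕ (lookup w (Fin.cast e i))
word⇒pointwise (x ∷ v) (y ∷ w) e eq zero = ListP.∷-injectiveˡ eq
word⇒pointwise (x ∷ v) (y ∷ w) e eq (suc i) = word⇒pointwise v w (cong ℕ.pred e) (ListP.∷-injectiveʳ eq) i

pointwise⇒word : ∀ {a b n m} (v : Vec (Fin a) n) (w : Vec (Fin b) m) (e : n ≡ m) →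
  (∀ i → toℕ (lookup v i) ≡ toℕ (lookup w (Fin.cast e i))) → word v ≡ word w
pointwise⇒word [] [] e h = refl
pointwise⇒word (x ∷ v) (y ∷ w) e h = cong₂ _∷_ (h zero) (pointwise⇒word v w (cong ℕ.pred e) (λ i → h (suc i)))

ΔPblock : ∀ {n} → Perm n → (k l : ℕ) → Perm (k + l) → List (SPerm × SPerm)
ΔPblock σ k l ζ = concatMap (λ σ₁ → concatMap (λ σ₂ →
             if word σ ==ₗ word (inv ζ ∘ₚ (σ₁ ⊗ₚ σ₂))
             then [ ((k , σ₁) , (l , σ₂)) ] else [])
           (Sym l)) (Sym k)

ΔPterm : ∀ {n} → Perm n → (k l : ℕ) → List (SPerm × SPerm)
ΔPterm σ k l = concatMap (ΔPblock σ k l) (Sh k l)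

record Deconc {n : ℕ} (σ : Perm n) (k l : ℕ) : Set where
  constructor deconc
  field
    ζ : Perm (k + l)
    σ₁ : Perm k
    σ₂ : Perm l
    ζ∈ : ζ ∈ Sh k l
    σ₁∈ : σ₁ ∈ Sym k
    σ₂∈ : σ₂ ∈ Sym l
    valid : Valid σ ζ σ₁ σ₂

  term : SPerm × SPerm
  term = (k , σ₁) , (l , σ₂)

  ζ-perm : IsPerm ζ
  ζ-perm = proj₁ (Sh-sound k l ζ∈)

  ζ-shuffle : ShufP k l ζ
  ζ-shuffle = proj₂ (Sh-sound k l ζ∈)

  σ₁-perm : IsPerm σ₁
  σ₁-perm = Sym-sound σ₁∈

  σ₂-perm : IsPerm σ₂
  σ₂-perm = Sym-sound σ₂∈

open Deconc public using (term)

-- With ρ = σ⁻¹, the vertex v is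
-- at position ρ v of σ; the shuffle ζ sends v to the left block iff
-- ρ v < k, and then ρ v = σ₁⁻¹ of its image, otherwise k + σ₂⁻¹ of it.
module Positions {n k l : ℕ} (eq : k + l ≡ n) (σ : Perm n) (hσ : IsPerm σ) (D : Deconc σ k l) where
  open Deconc D

  c : Fin n → Fin (k + l)
  c = Fin.cast (sym eq)

  c⁻ : Fin (k + l) → Fin n
  c⁻ = Fin.cast eq

  toℕ-c : ∀ i → toℕ (c i) ≡ toℕ i
  toℕ-c i = FinP.toℕ-cast (sym eq) i

  cc⁻ : ∀ j → c (c⁻ j) ≡ j
  cc⁻ j = FinP.toℕ-injective (trans (toℕ-c _) (FinP.toℕ-cast eq j))

  c⁻c : ∀ i → c⁻ (c i) ≡ i
  c⁻c i = FinP.toℕ-injective (trans (FinP.toℕ-cast eq _) (toℕ-c i))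

  τ : Perm (k + l)
  τ = inv ζ ∘ₚ (σ₁ ⊗ₚ σ₂)

  σ≈τ : ∀ i → lookup τ (c i) ≡ c (lookup σ i)
  σ≈τ i = FinP.toℕ-injective (trans (sym (word⇒pointwise σ τ (sym eq) valid i)) (sym (toℕ-c (lookup σ i))))

  ρ : Fin n → Fin n
  ρ = lookup (inv σ)

  ζ-at : ∀ v → lookup ζ (c v) ≡ lookup (σ₁ ⊗ₚ σ₂) (c (ρ v))
  ζ-at v = begin
    lookup ζ (c v)                      ≡⟨ cong (lookup ζ ∘ c) (sym (σ-inv σ hσ v)) ⟩
    lookup ζ (c (lookup σ (ρ v)))       ≡⟨ cong (lookup ζ) (sym (σ≈τ (ρ v))) ⟩
    lookup ζ (lookup τ (c (ρ v)))       ≡⟨ cong (lookup ζ) (lookup-∘ₚ (inv ζ) (σ₁ ⊗ₚ σ₂) _) ⟩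
    lookup ζ (lookup (inv ζ) (lookup (σ₁ ⊗ₚ σ₂) (c (ρ v)))) ≡⟨ σ-inv ζ ζ-perm _ ⟩
    lookup (σ₁ ⊗ₚ σ₂) (c (ρ v))         ∎
    where open ≡-Reasoning

  left-position : ∀ v a → lookup ζ (c v) ≡ a ↑ˡ l → toℕ (ρ v) ≡ toℕ (lookup (inv σ₁) a)
  left-position v a e with splitEq k l (c (ρ v))
  ... | inj₁ (a₀ , e₀) = begin
    toℕ (ρ v)                 ≡⟨ sym (toℕ-c (ρ v)) ⟩
    toℕ (c (ρ v))             ≡⟨ cong toℕ e₀ ⟩
    toℕ (a₀ ↑ˡ l)             ≡⟨ FinP.toℕ-↑ˡ a₀ l ⟩
    toℕ a₀                    ≡⟨ cong toℕ (sym (inv-spec σ₁ σ₁-perm a₀ a σ₁a₀)) ⟩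
    toℕ (lookup (inv σ₁) a)   ∎
    where
    open ≡-Reasoning
    σ₁a₀ : lookup σ₁ a₀ ≡ a
    σ₁a₀ = FinP.↑ˡ-injective l _ _ (trans (sym (lookup-⊗ˡ σ₁ σ₂ a₀))
             (trans (cong (lookup (σ₁ ⊗ₚ σ₂)) (sym e₀)) (trans (sym (ζ-at v)) e)))
  ... | inj₂ (b₀ , e₀) =
    ⊥-elim (↑ˡ≢↑ʳ _ _ (trans (sym e) (trans (ζ-at v) (trans (cong (lookup (σ₁ ⊗ₚ σ₂)) e₀) (lookup-⊗ʳ σ₁ σ₂ b₀)))))

  right-position : ∀ v b → lookup ζ (c v) ≡ k ↑ʳ b → toℕ (ρ v) ≡ k + toℕ (lookup (inv σ₂) b)
  right-position v b e with splitEq k l (c (ρ v))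
  ... | inj₂ (b₀ , e₀) = begin
    toℕ (ρ v)                     ≡⟨ sym (toℕ-c (ρ v)) ⟩
    toℕ (c (ρ v))                 ≡⟨ cong toℕ e₀ ⟩
    toℕ (k ↑ʳ b₀)                 ≡⟨ FinP.toℕ-↑ʳ k b₀ ⟩
    k + toℕ b₀                    ≡⟨ cong (λ z → k + toℕ z) (sym (inv-spec σ₂ σ₂-perm b₀ b σ₂b₀)) ⟩
    k + toℕ (lookup (inv σ₂) b)   ∎
    where
    open ≡-Reasoning
    σ₂b₀ : lookup σ₂ b₀ ≡ b
    σ₂b₀ = FinP.↑ʳ-injective k _ _ (trans (sym (lookup-⊗ʳ σ₁ σ₂ b₀))
             (trans (cong (lookup (σ₁ ⊗ₚ σ₂)) (sym e₀)) (trans (sym (ζ-at v)) e)))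
  ... | inj₁ (a₀ , e₀) =
    ⊥-elim (↑ˡ≢↑ʳ _ _ (trans (sym (lookup-⊗ˡ σ₁ σ₂ a₀)) (trans (cong (lookup (σ₁ ⊗ₚ σ₂)) (sym e₀)) (trans (sym (ζ-at v)) e))))

  left⇒early : ∀ v → LeftOf ζ (c v) → toℕ (ρ v) ℕ.< k
  left⇒early v (a , e) = subst (ℕ._< k) (sym (left-position v a e)) (FinP.toℕ<n _)

  early⇒left : ∀ v → toℕ (ρ v) ℕ.< k → LeftOf ζ (c v)
  early⇒left v lt with splitEq k l (lookup ζ (c v))
  ... | inj₁ p = p
  ... | inj₂ (b , e) = ⊥-elim (ℕP.<⇒≱ lt (subst (k ℕ.≤_) (sym (right-position v b e)) (ℕP.m≤m+n k _)))

same-shuffle : ∀ {n k l} (eq : k + l ≡ n) {σ σ' : Perm n} (hσ : IsPerm σ) (hσ' : IsPerm σ')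
  (D : Deconc σ k l) (D' : Deconc σ' k l) →
  (∀ v → toℕ (lookup (inv σ) v) ℕ.< k → toℕ (lookup (inv σ') v) ℕ.< k) →
  (∀ v → toℕ (lookup (inv σ') v) ℕ.< k → toℕ (lookup (inv σ) v) ℕ.< k) →
  Deconc.ζ D ≡ Deconc.ζ D'
same-shuffle eq hσ hσ' D D' early early' =
  shuffle-unique (Deconc.ζ D) (Deconc.ζ D') (Deconc.ζ-perm D) (Deconc.ζ-perm D') (Deconc.ζ-shuffle D) (Deconc.ζ-shuffle D')
    (λ j L → subst (LeftOf (Deconc.ζ D')) (P.cc⁻ j)
               (P'.early⇒left (P.c⁻ j) (early _ (P.left⇒early (P.c⁻ j) (subst (LeftOf (Deconc.ζ D)) (sym (P.cc⁻ j)) L)))))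
    (λ j L → subst (LeftOf (Deconc.ζ D)) (P.cc⁻ j)
               (P.early⇒left (P.c⁻ j) (early' _ (P'.left⇒early (P.c⁻ j) (subst (LeftOf (Deconc.ζ D')) (sym (P.cc⁻ j)) L)))))
  where
  module P = Positions eq _ hσ D
  module P' = Positions eq _ hσ' D'

permutation-unique : ∀ {n k l} (eq : k + l ≡ n) {σ σ' : Perm n} (hσ : IsPerm σ) (hσ' : IsPerm σ')
  (D : Deconc σ k l) (D' : Deconc σ' k l) → term D ≡ term D' →
  (∀ v → toℕ (lookup (inv σ) v) ℕ.< k → toℕ (lookup (inv σ') v) ℕ.< k) →
  (∀ v → toℕ (lookup (inv σ') v) ℕ.< k → toℕ (lookup (inv σ) v) ℕ.< k) → σ ≡ σ'
permutation-unique {k = k} {l} eq {σ} {σ'} hσ hσ' D D' same early early' = vec-ext λ i →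
  trans (sym (P.c⁻c _)) (trans (cong P.c⁻ (trans (sym (P.σ≈τ i)) (trans (τ≡ (P.c i)) (P'.σ≈τ i)))) (P.c⁻c _))
  where
  module P = Positions eq σ hσ D
  module P' = Positions eq σ' hσ' D'
  σ₁≡ : Deconc.σ₁ D ≡ Deconc.σ₁ D'
  σ₁≡ = sperm-injective (cong (proj₁) same)
  σ₂≡ : Deconc.σ₂ D ≡ Deconc.σ₂ D'
  σ₂≡ = sperm-injective (cong (proj₂) same)
  τ≡ : ∀ j → lookup P.τ j ≡ lookup P'.τ j
  τ≡ j = cong₂ (λ z t → lookup (inv z ∘ₚ t) j) (same-shuffle eq hσ hσ' D D' early early') (cong₂ _⊗ₚ_ σ₁≡ σ₂≡)

ΔPblock-elim : ∀ {n} (σ : Perm n) k l {ζ p} → ζ ∈ Sh k l → p ∈ ΔPblock σ k l ζ →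
  Σ (Deconc σ k l) λ D → Deconc.ζ D ≡ ζ × p ≡ term D
ΔPblock-elim σ k l {ζ} ζ∈ p∈ with ∈-concatMap-elim _ (Sym k) p∈
... | σ₁ , σ₁∈ , p∈₁ with ∈-concatMap-elim _ (Sym l) p∈₁
... | σ₂ , σ₂∈ , p∈₂ with ∈-if-elim (word σ ==ₗ word (inv ζ ∘ₚ (σ₁ ⊗ₚ σ₂))) p∈₂
... | t , eq = deconc ζ σ₁ σ₂ ζ∈ σ₁∈ σ₂∈ (==ₗ-sound _ _ t) , refl , eq

ΔPterm-elim : ∀ {n} (σ : Perm n) k l {p} → p ∈ ΔPterm σ k l → Σ (Deconc σ k l) λ D → p ≡ term D
ΔPterm-elim σ k l p∈ with ∈-concatMap-elim (ΔPblock σ k l) (Sh k l) p∈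
... | ζ , ζ∈ , p∈' = let (D , _ , eq) = ΔPblock-elim σ k l ζ∈ p∈' in D , eq

ΔPterm-intro : ∀ {n} (σ : Perm n) k l (D : Deconc σ k l) → term D ∈ ΔPterm σ k l
ΔPterm-intro σ k l (deconc ζ σ₁ σ₂ ζ∈ σ₁∈ σ₂∈ v) =
  ∈-concatMap-intro _ ζ∈ (∈-concatMap-intro _ σ₁∈ (∈-concatMap-intro _ σ₂∈
    (∈-if-intro (word σ ==ₗ word (inv ζ ∘ₚ (σ₁ ⊗ₚ σ₂))) (subst (λ w → T (word σ ==ₗ w)) v (==ₗ-complete (word σ))))))

ΔPterm-unique : ∀ {n} (σ : Perm n) → IsPerm σ → ∀ k l → k + l ≡ n → Unique (ΔPterm σ k l)
ΔPterm-unique σ hσ k l eq = uniq-concatMap (ΔPblock σ k l) (Sh k l) (Sh-unique k l) block-unique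
  (λ ζ ζ' z ζ∈ ζ'∈ z∈ z∈' →
    let (D , eD , _) = ΔPblock-elim σ k l ζ∈ z∈ ; (D' , eD' , _) = ΔPblock-elim σ k l ζ'∈ z∈' in
    trans (sym eD) (trans (same-shuffle eq hσ hσ D D' (λ _ lt → lt) (λ _ lt → lt)) eD'))
  where
  entry : Perm (k + l) → Perm k → Perm l → List (SPerm × SPerm)
  entry ζ σ₁ σ₂ = if word σ ==ₗ word (inv ζ ∘ₚ (σ₁ ⊗ₚ σ₂)) then [ ((k , σ₁) , (l , σ₂)) ] else []
  entry-term : ∀ ζ σ₁ σ₂ {z} → z ∈ entry ζ σ₁ σ₂ → z ≡ ((k , σ₁) , (l , σ₂))
  entry-term ζ σ₁ σ₂ z∈ = proj₂ (∈-if-elim (word σ ==ₗ word (inv ζ ∘ₚ (σ₁ ⊗ₚ σ₂))) z∈)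
  row-head : ∀ ζ σ₁ {z} → z ∈ concatMap (entry ζ σ₁) (Sym l) → proj₁ z ≡ (k , σ₁)
  row-head ζ σ₁ z∈ = let (σ₂ , _ , z∈') = ∈-concatMap-elim (entry ζ σ₁) (Sym l) z∈ in
    cong proj₁ (entry-term ζ σ₁ σ₂ z∈')
  block-unique : ∀ ζ → ζ ∈ Sh k l → Unique (ΔPblock σ k l ζ)
  block-unique ζ _ = uniq-concatMap (λ σ₁ → concatMap (entry ζ σ₁) (Sym l)) (Sym k) (Sym-unique k)
    (λ σ₁ _ → uniq-concatMap (entry ζ σ₁) (Sym l) (Sym-unique l) (λ σ₂ _ → uniq-if _ _)
      (λ σ₂ σ₂' z _ _ z∈ z∈' → sperm-injective (cong proj₂ (trans (sym (entry-term ζ σ₁ σ₂ z∈)) (entry-term ζ σ₁ σ₂' z∈')))))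
    (λ σ₁ σ₁' z _ _ z∈ z∈' → sperm-injective (trans (sym (row-head ζ σ₁ z∈)) (row-head ζ σ₁' z∈')))

-- To compare Δ(Θ F) with (Θ ⊗ Θ)(Δ F), every term is tagged by a set of
-- vertices: a term of ΔP σ splitting σ after its first k letters by the
-- set of the remaining letters, and a term coming from an admissible cut c
-- by its leaf set.  Both tagged lists are duplicate-free, and they have
-- the same members.

Tagged : ℕ → Set
Tagged n = Vec Bool n × (SPerm × SPerm)

lateSet : ∀ {n} → Perm n → ℕ → Vec Bool n
lateSet σ k = tabulate (λ v → not (toℕ (lookup (inv σ) v) ℕ.<ᵇ k))

ΘΘterm : ∀ {n} → Forest n → Vec Bool n → List (SPerm × SPerm)
ΘΘterm F c = concatMap (λ s₁ → List.map (λ s₂ → ((count (rooSet F c) , s₁) , (count (leaSet F c) , s₂)))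
               (Θ (restrict (leaSet F c) F))) (Θ (restrict (rooSet F c) F))

splitsOf : ∀ {n} → Perm n → List (Tagged n)
splitsOf {n} σ = concatMap (λ k → List.map (lateSet σ k ,_) (ΔPterm σ k (n ∸ k))) (upTo (suc n))

taggedΔΘ : ∀ {n} → Forest n → List (Tagged n)
taggedΔΘ F = concatMap splitsOf (Θ F)

cutTerms : ∀ {n} → Forest n → Vec Bool n → List (Tagged n)
cutTerms F c = if admissible F c then List.map (leaSet F c ,_) (ΘΘterm F c) else []

taggedΘΘΔ : ∀ {n} → Forest n → List (Tagged n)
taggedΘΘΔ {n} F = concatMap (cutTerms F) (allSubsets n)

untag : ∀ {A B : Set} (a : A) (ys : List B) → List.map proj₂ (List.map (a ,_) ys) ≡ ys
untag a ys = trans (sym (ListP.map-∘ ys)) (ListP.map-id ys)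

concatMap-concatMap : ∀ {A B C : Set} (h : B → List C) (g : A → List B) (xs : List A) →
  concatMap h (concatMap g xs) ≡ concatMap (concatMap h ∘ g) xs
concatMap-concatMap h g [] = refl
concatMap-concatMap h g (x ∷ xs) =
  trans (ListP.concatMap-++ h (g x) (concatMap g xs)) (cong (concatMap h (g x) ++_) (concatMap-concatMap h g xs))

ΔΘ-untag : ∀ {n} (F : Forest n) → ΔFQ (Θ F) ≡ List.map proj₂ (taggedΔΘ F)
ΔΘ-untag {n} F = sym (trans (ListP.map-concatMap proj₂ _ (Θ F)) (ListP.concatMap-cong (λ σ →
  trans (ListP.map-concatMap proj₂ _ (upTo (suc n))) (ListP.concatMap-cong (λ k → untag _ _) (upTo (suc n)))) (Θ F)))

ΘΘΔ-untag : ∀ {n} (F : Forest n) → ΘΘ (ΔH F) ≡ List.map proj₂ (taggedΘΘΔ F)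
ΘΘΔ-untag {n} F = trans (concatMap-concatMap _ _ (allSubsets n))
  (sym (trans (ListP.map-concatMap proj₂ _ (allSubsets n)) (ListP.concatMap-cong per-cut (allSubsets n))))
  where
  per-cut : ∀ c → List.map proj₂ (if admissible F c then List.map (leaSet F c ,_) (ΘΘterm F c) else [])
           ≡ concatMap _ (if admissible F c then _ else [])
  per-cut c with admissible F c
  ... | true = trans (untag _ _) (sym (ListP.++-identityʳ _))
  ... | false = refl

allSubsets-complete : ∀ n (c : Vec Bool n) → c ∈ allSubsets n
allSubsets-complete zero [] = here refl
allSubsets-complete (suc n) (b ∷ c) =
  ∈-concatMap-intro (λ b → List.map (b ∷_) (allSubsets n)) (bool∈ b) (MemP.∈-map⁺ (b ∷_) (allSubsets-complete n c))
  where
  bool∈ : ∀ b → b ∈ (true ∷ false ∷ [])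
  bool∈ true = here refl
  bool∈ false = there (here refl)

allSubsets-unique : ∀ n → Unique (allSubsets n)
allSubsets-unique zero = All.[] ∷ []
allSubsets-unique (suc n) =
  uniq-concatMap (λ b → List.map (b ∷_) (allSubsets n)) (true ∷ false ∷ []) (((λ ()) All.∷ All.[]) ∷ (All.[] ∷ []))
    (λ b _ → uniq-map (b ∷_) (allSubsets n) (allSubsets-unique n) (λ x y _ _ eq → VecP.∷-injectiveʳ eq))
    (λ b b' z _ _ z∈ z∈' → same-head z∈ z∈')
  where
  same-head : ∀ {b b' : Bool} {z} → z ∈ List.map (b ∷_) (allSubsets n) → z ∈ List.map (b' ∷_) (allSubsets n) → b ≡ b'
  same-head z∈ z∈' with MemP.∈-map⁻ _ z∈ | MemP.∈-map⁻ _ z∈'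
  ... | _ , _ , refl | _ , _ , eq = VecP.∷-injectiveˡ eq

ΘΘterm-unique : ∀ {n} (F : Forest n) c → Unique (ΘΘterm F c)
ΘΘterm-unique F c = uniq-concatMap _ (Θ (restrict (rooSet F c) F)) (Θ-unique _)
  (λ s₁ _ → uniq-map _ (Θ (restrict (leaSet F c) F)) (Θ-unique _) (λ x y _ _ eq → sperm-injective (cong proj₂ eq)))
  (λ s₁ s₁' z _ _ z∈ z∈' → same-first (MemP.∈-map⁻ _ z∈) (MemP.∈-map⁻ _ z∈'))
  where
  same-first : ∀ {s₁ s₁' : Perm (count (rooSet F c))} {z : SPerm × SPerm} →
    (∃[ s₂ ] (s₂ ∈ Θ (restrict (leaSet F c) F) × z ≡ ((count (rooSet F c) , s₁) , (count (leaSet F c) , s₂)))) →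
    (∃[ s₂ ] (s₂ ∈ Θ (restrict (leaSet F c) F) × z ≡ ((count (rooSet F c) , s₁') , (count (leaSet F c) , s₂)))) → s₁ ≡ s₁'
  same-first (_ , _ , e) (_ , _ , e') = sperm-injective (cong proj₁ (trans (sym e) e'))

cutTerm : ∀ {n} (F : Forest n) c → Perm (count (rooSet F c)) → Perm (count (leaSet F c)) → Tagged n
cutTerm F c s₁ s₂ = leaSet F c , ((count (rooSet F c) , s₁) , (count (leaSet F c) , s₂))

taggedΘΘΔ-intro : ∀ {n} (F : Forest n) c {s₁ s₂} → T (admissible F c) →
  s₁ ∈ Θ (restrict (rooSet F c) F) → s₂ ∈ Θ (restrict (leaSet F c) F) → cutTerm F c s₁ s₂ ∈ taggedΘΘΔ F
taggedΘΘΔ-intro {n} F c {s₁} {s₂} adm s₁∈ s₂∈ =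
  ∈-concatMap-intro (cutTerms F)
    (allSubsets-complete n c) (if-admissible (admissible F c) adm)
  where
  term∈ : ((count (rooSet F c) , s₁) , (count (leaSet F c) , s₂)) ∈ ΘΘterm F c
  term∈ = ∈-concatMap-intro _ s₁∈ (MemP.∈-map⁺ (λ s₂ → ((count (rooSet F c) , s₁) , (count (leaSet F c) , s₂))) s₂∈)
  if-admissible : ∀ b → T b → cutTerm F c s₁ s₂ ∈ (if b then List.map (leaSet F c ,_) (ΘΘterm F c) else [])
  if-admissible true _ = MemP.∈-map⁺ (leaSet F c ,_) term∈

record CutTerm {n : ℕ} (F : Forest n) (z : Tagged n) : Set where
  constructor cutTerm∈
  field
    c : Vec Bool n
    adm : T (admissible F c)
    s₁ : Perm (count (rooSet F c))
    s₂ : Perm (count (leaSet F c))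
    s₁∈ : s₁ ∈ Θ (restrict (rooSet F c) F)
    s₂∈ : s₂ ∈ Θ (restrict (leaSet F c) F)
    z≡ : z ≡ cutTerm F c s₁ s₂

ΘΘterm-elim : ∀ {n} (F : Forest n) c {p} → p ∈ ΘΘterm F c →
  ∃[ s₁ ] ∃[ s₂ ] (s₁ ∈ Θ (restrict (rooSet F c) F) × s₂ ∈ Θ (restrict (leaSet F c) F) ×
    p ≡ ((count (rooSet F c) , s₁) , (count (leaSet F c) , s₂)))
ΘΘterm-elim F c p∈ with ∈-concatMap-elim _ (Θ (restrict (rooSet F c) F)) p∈
... | s₁ , s₁∈ , p∈' with MemP.∈-map⁻ _ p∈'
... | s₂ , s₂∈ , eq = s₁ , s₂ , s₁∈ , s₂∈ , eq

taggedΘΘΔ-elim : ∀ {n} (F : Forest n) {z} → z ∈ taggedΘΘΔ F → CutTerm F z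
taggedΘΘΔ-elim {n} F {z} z∈ =
  let (c , _ , z∈c) = ∈-concatMap-elim (cutTerms F) (allSubsets n) z∈
  in from-cut c (admissible F c) refl z∈c
  where
  from-cut : ∀ c b → b ≡ admissible F c → z ∈ (if b then List.map (leaSet F c ,_) (ΘΘterm F c) else []) → CutTerm F z
  from-cut c true adm z∈c with MemP.∈-map⁻ (leaSet F c ,_) z∈c
  ... | p , p∈ , refl = let (s₁ , s₂ , s₁∈ , s₂∈ , e) = ΘΘterm-elim F c p∈ in
    cutTerm∈ c (subst T adm tt) s₁ s₂ s₁∈ s₂∈ (cong (leaSet F c ,_) e)

k+n∸k : ∀ {n k} → k ℕ.< suc n → k + (n ∸ k) ≡ n
k+n∸k lt = ℕP.m+[n∸m]≡n (ℕ.s≤s⁻¹ lt)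

record SplitOf {n : ℕ} (σ : Perm n) (z : Tagged n) : Set where
  constructor splitOf
  field
    k : ℕ
    k≤n : k ℕ.< suc n
    D : Deconc σ k (n ∸ k)
    z≡ : z ≡ (lateSet σ k , term D)

splitsOf-elim : ∀ {n} (σ : Perm n) {z} → z ∈ splitsOf σ → SplitOf σ z
splitsOf-elim {n} σ z∈ =
  let (k , k∈ , z∈k) = ∈-concatMap-elim _ (upTo (suc n)) z∈
      (p , p∈ , e) = MemP.∈-map⁻ (lateSet σ k ,_) z∈k
      (D , e') = ΔPterm-elim σ k (n ∸ k) p∈
  in splitOf k (MemP.∈-upTo⁻ k∈) D (trans e (cong (lateSet σ k ,_) e'))

taggedΔΘ-intro : ∀ {n} (F : Forest n) {σ k} → σ ∈ Θ F → k ℕ.< suc n → (D : Deconc σ k (n ∸ k)) →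
  (lateSet σ k , term D) ∈ taggedΔΘ F
taggedΔΘ-intro {n} F {σ} {k} σ∈ lt D =
  ∈-concatMap-intro splitsOf σ∈ (∈-concatMap-intro _ (MemP.∈-upTo⁺ lt) (MemP.∈-map⁺ (lateSet σ k ,_) (ΔPterm-intro σ k (n ∸ k) D)))

taggedΔΘ-intro-at : ∀ {n} (F : Forest n) {σ k l} → σ ∈ Θ F → k + l ≡ n → (D : Deconc σ k l) →
  (lateSet σ k , term D) ∈ taggedΔΘ F
taggedΔΘ-intro-at F {σ} {k} {l} σ∈ refl D =
  subst (λ t → (lateSet σ k , t) ∈ taggedΔΘ F) (retarget-term (ℕP.m+n∸m≡n k l) D)
    (taggedΔΘ-intro F σ∈ (s≤s (ℕP.m≤m+n k l)) (retarget (sym (ℕP.m+n∸m≡n k l)) D))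
  where
  retarget : ∀ {l l'} → l ≡ l' → Deconc σ k l → Deconc σ k l'
  retarget refl D = D
  retarget-term : ∀ {l l'} (e : l' ≡ l) (D : Deconc σ k l) → term (retarget (sym e) D) ≡ term D
  retarget-term refl D = refl

lateSet-lookup : ∀ {n} (σ : Perm n) k v → lookup (lateSet σ k) v ≡ not (toℕ (lookup (inv σ) v) ℕ.<ᵇ k)
lateSet-lookup σ k v = VecP.lookup∘tabulate _ v

late⇒ : ∀ {n} (σ : Perm n) k v → T (lookup (lateSet σ k) v) → k ℕ.≤ toℕ (lookup (inv σ) v)
late⇒ σ k v h = ℕP.≮⇒≥ λ lt → T-not-elim (subst T (lateSet-lookup σ k v) h) (ℕP.<⇒<ᵇ lt)

late⇐ : ∀ {n} (σ : Perm n) k v → k ℕ.≤ toℕ (lookup (inv σ) v) → T (lookup (lateSet σ k) v)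
late⇐ σ k v le = subst T (sym (lateSet-lookup σ k v)) (T-not-intro λ q → ℕP.<⇒≱ (ℕP.<ᵇ⇒< _ _ q) le)

early⇒¬late : ∀ {n} (σ : Perm n) k v → toℕ (lookup (inv σ) v) ℕ.< k → ¬ T (lookup (lateSet σ k) v)
early⇒¬late σ k v lt h = ℕP.<⇒≱ lt (late⇒ σ k v h)

¬late⇒early : ∀ {n} (σ : Perm n) k v → ¬ T (lookup (lateSet σ k) v) → toℕ (lookup (inv σ) v) ℕ.< k
¬late⇒early σ k v h = ℕP.≰⇒> λ le → h (late⇐ σ k v le)

same-early : ∀ {n} (σ σ' : Perm n) k → lateSet σ k ≡ lateSet σ' k →
  ∀ v → toℕ (lookup (inv σ) v) ℕ.< k → toℕ (lookup (inv σ') v) ℕ.< k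
same-early σ σ' k eq v lt = ¬late⇒early σ' k v (subst (λ L → ¬ T (lookup L v)) eq (early⇒¬late σ k v lt))

split-determines : ∀ {n} {σ σ' : Perm n} {z} → IsPerm σ → IsPerm σ' → SplitOf σ z → SplitOf σ' z → σ ≡ σ'
split-determines {n} {σ} {σ'} hσ hσ' (splitOf k lt D refl) (splitOf k' _ D' e') =
  aligned k' (cong (proj₁ ∘ proj₁ ∘ proj₂) e') D' e'
  where
  aligned : ∀ k' → k ≡ k' → (D' : Deconc σ' k' (n ∸ k')) → (lateSet σ k , term D) ≡ (lateSet σ' k' , term D') → σ ≡ σ'
  aligned .k refl D' eq = permutation-unique (k+n∸k lt) hσ hσ' D D' (cong proj₂ eq)
    (same-early σ σ' k (cong proj₁ eq)) (same-early σ' σ k (sym (cong proj₁ eq)))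

taggedΔΘ-unique : ∀ {n} (F : Forest n) → Unique (taggedΔΘ F)
taggedΔΘ-unique {n} F = uniq-concatMap splitsOf (Θ F) (Θ-unique F)
  (λ σ σ∈ → uniq-concatMap (λ k → List.map (lateSet σ k ,_) (ΔPterm σ k (n ∸ k))) (upTo (suc n)) (UniqP.upTo⁺ (suc n))
    (λ k k∈ → uniq-map _ (ΔPterm σ k (n ∸ k))
                (ΔPterm-unique σ (proj₁ (Θ-sound F σ∈)) k (n ∸ k) (k+n∸k (MemP.∈-upTo⁻ k∈)))
                (λ x y _ _ eq → cong proj₂ eq))
    (λ k k' z _ _ z∈ z∈' → trans (sym (size σ k z∈)) (size σ k' z∈')))
  (λ σ σ' z σ∈ σ'∈ z∈ z∈' →
    split-determines (proj₁ (Θ-sound F σ∈)) (proj₁ (Θ-sound F σ'∈)) (splitsOf-elim σ z∈) (splitsOf-elim σ' z∈'))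
  where
  size : ∀ σ k {z} → z ∈ List.map (lateSet σ k ,_) (ΔPterm σ k (n ∸ k)) → proj₁ (proj₁ (proj₂ z)) ≡ k
  size σ k z∈ = let (p , p∈ , e) = MemP.∈-map⁻ (lateSet σ k ,_) z∈ ; (D , e') = ΔPterm-elim σ k (n ∸ k) p∈ in
    cong (proj₁ ∘ proj₁) (trans (cong proj₂ e) e')

-- the leaf set of a cut determines the cut
taggedΘΘΔ-unique : ∀ {n} (F : Forest n) → IsForest F → Unique (taggedΘΘΔ F)
taggedΘΘΔ-unique {n} F hF = uniq-concatMap (cutTerms F) (allSubsets n) (allSubsets-unique n)
  (λ c _ → per-cut c (admissible F c))
  (λ c c' z _ _ z∈ z∈' → same-cut c c' z∈ z∈')
  where
  open ForestCuts F hF using (lea-inj)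
  per-cut : ∀ c b → Unique (if b then List.map (leaSet F c ,_) (ΘΘterm F c) else [])
  per-cut c true = uniq-map _ (ΘΘterm F c) (ΘΘterm-unique F c) (λ x y _ _ eq → cong proj₂ eq)
  per-cut c false = []
  tagged : ∀ c b → b ≡ admissible F c → ∀ {z} → z ∈ (if b then List.map (leaSet F c ,_) (ΘΘterm F c) else []) →
    T (admissible F c) × proj₁ z ≡ leaSet F c
  tagged c true e z∈ = let (_ , _ , e') = MemP.∈-map⁻ (leaSet F c ,_) z∈ in subst T e tt , cong proj₁ e'
  same-cut : ∀ c c' {z} → z ∈ cutTerms F c → z ∈ cutTerms F c' → c ≡ c'
  same-cut c c' z∈ z∈' =
    let (a , e) = tagged c _ refl z∈ ; (a' , e') = tagged c' _ refl z∈' in lea-inj c c' a a' (trans (sym e) e')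

module VertexShuffle {n : ℕ} (L : Vec Bool n) where

  R : Vec Bool n
  R = Vec.map not L

  eq : count R + count L ≡ n
  eq = trans (cong (λ X → count R + count X) (sym (not-not-vec L))) (count-complement R)

  c : Fin n → Fin (count R + count L)
  c = Fin.cast (sym eq)

  c⁻ : Fin (count R + count L) → Fin n
  c⁻ = Fin.cast eq

  cc⁻ : ∀ j → c (c⁻ j) ≡ j
  cc⁻ j = FinP.toℕ-injective (trans (FinP.toℕ-cast (sym eq) _) (FinP.toℕ-cast eq j))

  f : Fin (count R) → Fin (count R + count L)
  f a = c (emb R a)

  g : Fin (count L) → Fin (count R + count L)
  g b = c (emb L b)

  open Interleave f g (λ a b lt → cast-mono (sym eq) _ _ (emb-mono R a b lt)) (λ a b lt → cast-mono (sym eq) _ _ (emb-mono L a b lt))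
    (λ a b e → emb-disjoint L b a (sym (smono-inj c (cast-mono (sym eq)) _ _ e))) public

-- Every tagged term of Δ(Θ F) is a tagged term of (Θ ⊗ Θ)(Δ F): the letters
-- of σ ∈ Θ F after position k form an upward closed set L, the leaf set of
-- its cut, and the two factors of the term are linear extensions of the
-- subforests on R and on L, because their inverses list the positions of
-- σ⁻¹ on R and on L (shifted by k) in the same relative order.
module LeftToRight {n : ℕ} (F : Forest n) (hF : IsForest F) (σ : Perm n) (hσ : IsPerm σ) (Rσ : Resp F (lookup (inv σ))) where
  open ForestCuts F hF

  ρ : Fin n → Fin n
  ρ = lookup (inv σ)

  taggedΘΘΔ-intro-at : ∀ c L → leaSet F c ≡ L → T (admissible F c) →
    (s₁ : Perm (count (Vec.map not L))) (s₂ : Perm (count L)) →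
    s₁ ∈ Θ (restrict (Vec.map not L) F) → s₂ ∈ Θ (restrict L F) →
    (L , ((count (Vec.map not L) , s₁) , (count L , s₂))) ∈ taggedΘΘΔ F
  taggedΘΘΔ-intro-at c .(leaSet F c) refl adm s₁ s₂ = taggedΘΘΔ-intro F c adm

  module AtSplit (L : Vec Bool n) (D : Deconc σ (count (Vec.map not L)) (count L))
      (eq : count (Vec.map not L) + count L ≡ n)
      (late⇒ : ∀ v → T (lookup L v) → count (Vec.map not L) ℕ.≤ toℕ (ρ v))
      (late⇐ : ∀ v → count (Vec.map not L) ℕ.≤ toℕ (ρ v) → T (lookup L v)) where
    open Deconc D hiding (term)
    module P = Positions eq σ hσ D
    module V = VertexShuffle L

    k : ℕ
    k = count V.R

    early-R : ∀ v → T (lookup V.R v) → toℕ (ρ v) ℕ.< k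
    early-R v h = ℕP.≰⇒> λ le → not-in-complement L v h (late⇐ v le)

    R-early : ∀ v → toℕ (ρ v) ℕ.< k → T (lookup V.R v)
    R-early v lt = in-complement L v λ h → ℕP.<⇒≱ lt (late⇒ v h)

    -- the late letters lie above the earlier ones, since σ⁻¹ decreases downwards
    up : UpC L
    up v p e h = late⇐ v (ℕP.<⇒≤ (ℕP.≤-<-trans (late⇒ p h) (Rσ v p e)))

    ζ≡ : ζ ≡ V.ζ
    ζ≡ = shuffle-unique ζ V.ζ ζ-perm V.ζ-perm ζ-shuffle V.ζ-shuffle to from
      where
      to : ∀ j → LeftOf ζ j → LeftOf V.ζ j
      to j Lj = rk V.R v h , trans (cong (lookup V.ζ) j≡) (V.ζ-left (rk V.R v h))
        where
        v = P.c⁻ j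
        h = R-early v (P.left⇒early v (subst (LeftOf ζ) (sym (P.cc⁻ j)) Lj))
        j≡ : j ≡ V.f (rk V.R v h)
        j≡ = trans (sym (P.cc⁻ j)) (cong P.c (sym (emb-rk V.R v h)))
      from : ∀ j → LeftOf V.ζ j → LeftOf ζ j
      from j (a , e) = subst (LeftOf ζ) (sym (V.ζ-left⁻ j a e)) (P.early⇒left (emb V.R a) (early-R _ (emb-in V.R a)))

    ζ-R : ∀ a → lookup ζ (P.c (emb V.R a)) ≡ a ↑ˡ count L
    ζ-R a = trans (cong (λ z → lookup z (V.f a)) ζ≡) (V.ζ-left a)

    ζ-L : ∀ b → lookup ζ (P.c (emb L b)) ≡ k ↑ʳ b
    ζ-L b = trans (cong (λ z → lookup z (V.g b)) ζ≡) (V.ζ-right b)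

    -- σ₁⁻¹ and σ₂⁻¹ are σ⁻¹ on R and on L, up to increasing relabellings
    resp₁ : Resp (restrict V.R F) (lookup (inv σ₁))
    resp₁ a b e = subst₂ ℕ._<_ (P.left-position (emb V.R b) b (ζ-R b)) (P.left-position (emb V.R a) a (ζ-R a))
                    (Rσ (emb V.R a) (emb V.R b) (restrict-parent⁻ V.R F a b e))

    resp₂ : Resp (restrict L F) (lookup (inv σ₂))
    resp₂ a b e = ℕP.+-cancelˡ-< k _ _
      (subst₂ ℕ._<_ (P.right-position (emb L b) b (ζ-L b)) (P.right-position (emb L a) a (ζ-L a))
        (Rσ (emb L a) (emb L b) (restrict-parent⁻ L F a b e)))

    term∈ : (L , term D) ∈ taggedΘΘΔ F
    term∈ = taggedΘΘΔ-intro-at (cutOf L) L (cut-lea L up) (cut-adm L up) σ₁ σ₂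
      (Θ-complete _ σ₁ σ₁-perm resp₁) (Θ-complete _ σ₂ σ₂-perm resp₂)

  split-term : ∀ (L : Vec Bool n) k l (eq : k + l ≡ n) (D : Deconc σ k l) →
    (∀ v → T (lookup L v) → k ℕ.≤ toℕ (ρ v)) → (∀ v → k ℕ.≤ toℕ (ρ v) → T (lookup L v)) →
    count (Vec.map not L) ≡ k → count L ≡ l → (L , term D) ∈ taggedΘΘΔ F
  split-term L .(count (Vec.map not L)) .(count L) eq D late⇒ late⇐ refl refl = AtSplit.term∈ L D eq late⇒ late⇐

  left⊆right : ∀ k → k ℕ.< suc n → (D : Deconc σ k (n ∸ k)) → (lateSet σ k , term D) ∈ taggedΘΘΔ F
  left⊆right k lt D =
    split-term L k (n ∸ k) (k+n∸k lt) D (late⇒ σ k) (late⇐ σ k) (proj₁ counts)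
      (trans (cong count (sym (not-not-vec L))) (proj₂ counts))
    where
    L = lateSet σ k
    counts : count (Vec.map not L) ≡ k × count (Vec.map not (Vec.map not L)) ≡ n ∸ k
    counts = count-split (Vec.map not L) ρ (inv-perm σ hσ)
      (λ v h → ¬late⇒early σ k v (not-in-complement L v h))
      (λ v h → ℕP.≮⇒≥ λ lt → h (in-complement L v (early⇒¬late σ k v lt)))
      (k+n∸k lt)

-- Every tagged term of (Θ ⊗ Θ)(Δ F) is a tagged term of Δ(Θ F): for an
-- admissible cut with leaf set L and linear extensions s₁, s₂ of the two
-- subforests, σ = ζ⁻¹ ∘ (s₁ ⊗ s₂) with ζ the shuffle of (R, L) is a linear
-- extension of F whose last letters are L, and (s₁, s₂) is its term at k = |R|.
module RightToLeft {n : ℕ} (F : Forest n) (hF : IsForest F) (c : Vec Bool n) (adm : T (admissible F c))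
    (s₁ : Perm (count (rooSet F c))) (s₂ : Perm (count (leaSet F c)))
    (s₁∈ : s₁ ∈ Θ (restrict (rooSet F c) F)) (s₂∈ : s₂ ∈ Θ (restrict (leaSet F c) F)) where
  open ForestCuts F hF
  L = leaSet F c
  module V = VertexShuffle L
  R = V.R
  k = count R
  l = count L

  h₁ : IsPerm s₁
  h₁ = proj₁ (Θ-sound _ s₁∈)
  h₂ : IsPerm s₂
  h₂ = proj₁ (Θ-sound _ s₂∈)

  τ : Perm (k + l)
  τ = inv V.ζ ∘ₚ (s₁ ⊗ₚ s₂)

  σ : Perm n
  σ = tabulate (λ i → V.c⁻ (lookup τ (V.c i)))

  σ-at : ∀ i → lookup σ i ≡ V.c⁻ (lookup τ (V.c i))
  σ-at i = VecP.lookup∘tabulate _ i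

  σ-perm : IsPerm σ
  σ-perm i j e = smono-inj V.c (cast-mono (sym V.eq)) i j
    (∘ₚ-perm (inv V.ζ) (s₁ ⊗ₚ s₂) (inv-perm V.ζ V.ζ-perm) (⊗ₚ-perm s₁ s₂ h₁ h₂) _ _
      (smono-inj V.c⁻ (cast-mono V.eq) _ _ (trans (sym (σ-at i)) (trans e (σ-at j)))))

  D : Deconc σ k l
  D = deconc V.ζ s₁ s₂ (Sh-complete k l V.ζ V.ζ-perm V.ζ-shuffle) (Sym-complete s₁ h₁) (Sym-complete s₂ h₂)
    (pointwise⇒word σ τ (sym V.eq) λ i → trans (cong toℕ (σ-at i)) (FinP.toℕ-cast V.eq _))

  module P = Positions V.eq σ σ-perm D

  ρ : Fin n → Fin n
  ρ = lookup (inv σ)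

  ρR : ∀ v (h : T (lookup R v)) → toℕ (ρ v) ≡ toℕ (lookup (inv s₁) (rk R v h))
  ρR v h = P.left-position v (rk R v h) (trans (cong (lookup V.ζ ∘ V.c) (sym (emb-rk R v h))) (V.ζ-left (rk R v h)))

  ρL : ∀ v (h : T (lookup L v)) → toℕ (ρ v) ≡ k + toℕ (lookup (inv s₂) (rk L v h))
  ρL v h = P.right-position v (rk L v h) (trans (cong (lookup V.ζ ∘ V.c) (sym (emb-rk L v h))) (V.ζ-right (rk L v h)))

  R-early : ∀ v → T (lookup R v) → toℕ (ρ v) ℕ.< k
  R-early v h = subst (ℕ._< k) (sym (ρR v h)) (FinP.toℕ<n _)

  L-late : ∀ v → T (lookup L v) → k ℕ.≤ toℕ (ρ v)
  L-late v h = subst (k ℕ.≤_) (sym (ρL v h)) (ℕP.m≤m+n k _)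

  -- an edge v → p stays inside R, stays inside L, or goes from L down to R
  σ-resp : Resp F ρ
  σ-resp v p e with T-dec (lookup L p)
  ... | inj₁ hp =
    let hv = lea-up c v p e hp in
    subst₂ ℕ._<_ (sym (ρL p hp)) (sym (ρL v hv))
      (ℕP.+-monoʳ-< k (proj₂ (Θ-sound _ s₂∈) (rk L v hv) (rk L p hp)
        (restrict-parent⁺ L F (rk L v hv) p (trans (cong (lookup F) (emb-rk L v hv)) e) hp)))
  ... | inj₂ np with T-dec (lookup L v)
  ...   | inj₁ hv = ℕP.<-≤-trans (R-early p (in-complement L p (T-not-elim np))) (L-late v hv)
  ...   | inj₂ nv =
    let hp = in-complement L p (T-not-elim np) ; hv = in-complement L v (T-not-elim nv) in
    subst₂ ℕ._<_ (sym (ρR p hp)) (sym (ρR v hv))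
      (proj₂ (Θ-sound _ s₁∈) (rk R v hv) (rk R p hp)
        (restrict-parent⁺ R F (rk R v hv) p (trans (cong (lookup F) (emb-rk R v hv)) e) hp))

  late≡L : lateSet σ k ≡ L
  late≡L = vec-ext λ v → T-ext (to v) (from v)
    where
    to : ∀ v → T (lookup (lateSet σ k) v) → T (lookup L v)
    to v h with T-dec (lookup L v)
    ... | inj₁ q = q
    ... | inj₂ q = ⊥-elim (ℕP.<⇒≱ (R-early v (in-complement L v (T-not-elim q))) (late⇒ σ k v h))
    from : ∀ v → T (lookup L v) → T (lookup (lateSet σ k) v)
    from v h = late⇐ σ k v (L-late v h)

  right⊆left : cutTerm F c s₁ s₂ ∈ taggedΔΘ F
  right⊆left = subst (λ X → (X , term D) ∈ taggedΔΘ F) late≡L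
    (taggedΔΘ-intro-at F (Θ-complete F σ σ-perm σ-resp) V.eq D)

Θ-coproduct : ∀ {n} (F : Forest n) → IsForest F → ΔFQ (Θ F) ↭ ΘΘ (ΔH F)
Θ-coproduct F hF = subst₂ _↭_ (sym (ΔΘ-untag F)) (sym (ΘΘΔ-untag F))
  (PermP.map⁺ proj₂ (uniq-set-↭ (taggedΔΘ-unique F) (taggedΘΘΔ-unique F hF) left⊆right right⊆left))
  where
  from-split : ∀ {z σ} → σ ∈ Θ F → SplitOf σ z → z ∈ taggedΘΘΔ F
  from-split σ∈ (splitOf k lt D refl) =
    let (hσ , Rσ) = Θ-sound F σ∈ in LeftToRight.left⊆right F hF _ hσ Rσ k lt D
  left⊆right : ∀ z → z ∈ taggedΔΘ F → z ∈ taggedΘΘΔ F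
  left⊆right z z∈ = let (σ , σ∈ , z∈σ) = ∈-concatMap-elim splitsOf (Θ F) z∈ in from-split σ∈ (splitsOf-elim σ z∈σ)
  from-cut : ∀ {z} → CutTerm F z → z ∈ taggedΔΘ F
  from-cut (cutTerm∈ c adm s₁ s₂ s₁∈ s₂∈ refl) = RightToLeft.right⊆left F hF c adm s₁ s₂ s₁∈ s₂∈
  right⊆left : ∀ z → z ∈ taggedΘΘΔ F → z ∈ taggedΔΘ F
  right⊆left z z∈ = from-cut (taggedΘΘΔ-elim F z∈)

Θ-unit : Θ emptyForest ↭ [ [] ]
Θ-unit = ↭-refl

Θ-counit : ∀ (n : ℕ) (F : Forest n) → εFQ (Θ F) ≡ εH F
Θ-counit zero [] = refl
Θ-counit (suc n) F = refl

proposition1 :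
    (Θ emptyForest ↭ [ [] ])
    × (∀ (n : ℕ) (F : Forest n) → IsForest F → εFQ (Θ F) ≡ εH F)
    × (∀ (k l : ℕ) (F : Forest k) (G : Forest l) → IsForest F → IsForest G →
         Θ (F ·F G) ↭ mulFQ (Θ F) (Θ G))
    × (∀ (n : ℕ) (F : Forest n) → IsForest F → ΔFQ (Θ F) ↭ ΘΘ (ΔH F))
proposition1 =
  Θ-unit ,
  (λ n F _ → Θ-counit n F) ,
  (λ k l F G _ _ → Θ-product F G) ,
  (λ n F hF → Θ-coproduct F hF)
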